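{- Let $\lambda$ be a partition and $\phi$ a flag compatible with $\lambda$. Then $$G^\phi_\lambda(\beta;\mathbf{x};\mathbf{y})=\sum_{\nu\subseteq\lambda}G^{\phi^- }_\nu(\beta;\mathbf{x};\mathbf{y})\sum_{\mu\subseteq\nu:\ \nu/\mu\ \text{disconnected}}\beta^{|\nu|-|\mu|}\,G^\phi_{\lambda/\mu}(\beta;\mathbf{x}_+;\mathbf{y}).$$
   Context: $\beta$ an indeterminate; $\mathbf{x}=(x_i)_{i\in\mathbb{Z}}$, $\mathbf{y}=(y_i)_{i\in\mathbb{Z}}$; $a\ominus b=\frac{a-b}{1+\beta b}$. Partitions are Young diagrams in matrix coordinates $(r,c)$; $\lambda/\mu$ the cells of $\lambda$ not in $\mu$. A set-valued tableau of shape $\lambda/\mu$ assigns a nonempty finite subset of $\mathbb{Z}$ to each cell; semistandard: $\max T(r,c)\le\min T(r,c+1)$, $\max T(r,c)<\min T(r+1,c)$; weight $\mathrm{wt}(T)=\beta^{ -|\lambda/\mu|}\prod_{(r,c)\in\lambda/\mu}\prod_{i\in T(r,c)}\beta(x_i\ominus y_{i+c-r})$. A flag for $\lambda$ is a weakly increasing integer sequence of length $\ell(\lambda)$ (for $\nu\subseteq\lambda$ only the first $\ell(\nu)$ entries are used); it is compatible with $\lambda$ if $\phi_{i+1}-\phi_i\le\lambda_i-\lambda_{i+1}+1$ for $1\le i<\ell(\lambda)$. $G^\phi_\lambda(\beta;\mathbf{x};\mathbf{y})=\sum\mathrm{wt}(T)$ over semistandard $T$ of shape $\lambda$ with $\max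 T(r,c)\le\phi_r$; $G^\phi_{\lambda/\mu}(\beta;\mathbf{x}_+;\mathbf{y})=\sum\mathrm{wt}(T)$ over semistandard $T$ of shape $\lambda/\mu$ with all entries positive and $\max T(r,c)\le\phi_r$. $\phi^-_i=\min(\phi_i,0)$. A skew shape is disconnected if it contains no two horizontally or vertically adjacent cells. -}

module Defs where

open import Data.Nat as ℕ using (ℕ; zero; suc; _∸_; _<ᵇ_)
open import Data.Integer as ℤ using (ℤ; +_; _⊓_)
open import Data.Bool using (Bool; true; false; if_then_else_; T)
open import Data.Maybe using (Maybe; just; nothing; fromMaybe)
open import Data.List using (List; []; _∷_; _++_; replicate; length; map; foldr)
open import Data.Nat.ListAction using (sum)
open import Data.List.Relation.Unary.All using (All)
open import Data.List.Relation.Unary.Unique.Propositional using (Unique)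
open import Data.List.Membership.Propositional using (_∈_)
open import Data.List.Relation.Binary.Permutation.Propositional using (_↭_)
open import Data.Product using (Σ; _×_; _,_; proj₁; proj₂)
open import Data.Unit using (⊤)
open import Relation.Binary.PropositionalEquality using (_≡_)
open import Relation.Nullary using (¬_)

-- Lists indexed from 1 (row r, column c, flag entry φ_r, part λ_r)

nth : {A : Set} → List A → ℕ → Maybe A
nth []       _       = nothing
nth (x ∷ _)  zero    = just x
nth (_ ∷ xs) (suc k) = nth xs k

at : {A : Set} → List A → ℕ → Maybe A
at xs zero    = nothing
at xs (suc k) = nth xs k

part : List ℕ → ℕ → ℕ
part la r = fromMaybe 0 (at la r)

-- positive parts, weakly decreasing (canonical: no trailing zeros)
IsPartition : List ℕ → Set
IsPartition []               = ⊤
IsPartition (a ∷ [])         = 0 ℕ.< a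
IsPartition (a ∷ b ∷ rest)   = 0 ℕ.< a × b ℕ.≤ a × IsPartition (b ∷ rest)

_⊆P_ : List ℕ → List ℕ → Set
nu ⊆P la = length nu ℕ.≤ length la × ((r : ℕ) → part nu r ℕ.≤ part la r)

size : List ℕ → ℕ
size = sum

WeakInc : List ℤ → Set
WeakInc []             = ⊤
WeakInc (a ∷ [])       = ⊤
WeakInc (a ∷ b ∷ rest) = a ℤ.≤ b × WeakInc (b ∷ rest)

IsFlag : List ℕ → List ℤ → Set
IsFlag la phi = length phi ≡ length la × WeakInc phi

Compatible : List ℕ → List ℤ → Set
Compatible (l1 ∷ l2 ∷ ls) (f1 ∷ f2 ∷ fs) =
  (f2 ℤ.- f1) ℤ.≤ ((+ l1 ℤ.- + l2) ℤ.+ ℤ.1ℤ) × Compatible (l2 ∷ ls) (f2 ∷ fs)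
Compatible _ _ = ⊤

flagMinus : List ℤ → List ℤ
flagMinus = map (λ a → a ⊓ ℤ.0ℤ)

InSkew : List ℕ → List ℕ → ℕ → ℕ → Set
InSkew nu mu r c = 1 ℕ.≤ r × part mu r ℕ.< c × c ℕ.≤ part nu r

Disconnected : List ℕ → List ℕ → Set
Disconnected nu mu = (r c : ℕ) → InSkew nu mu r c →
  ¬ InSkew nu mu r (suc c) × ¬ InSkew nu mu (suc r) c

-- Each entry i of a cell (r,c) contributes the factor
--   β (x_i ⊖ y_j) = β (x_i - y_j) Σ_n (-β y_j)^n ,  j = i + c - r,
-- in the formal power series ring ℤ[[β, x, y]].  A "term" of this
-- expansion is an entry together with the choice of x_i (true) or
-- -y_j (false) and the exponent n.  An expanded tableau records the
-- rows (top to bottom) of cells (left to right, starting at column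
-- μ_r + 1), each cell being the list of its entries in increasing
-- order.

Entry : Set
Entry = ℤ × Bool × ℕ

key : Entry → ℤ
key = proj₁

Cell : Set
Cell = List Entry

Tab : Set
Tab = List (List Cell)

cellAt : Tab → List ℕ → ℕ → ℕ → Maybe Cell
cellAt Tb mu r c with at Tb r
... | nothing  = nothing
... | just row = if part mu r <ᵇ c then nth row (c ∸ suc (part mu r)) else nothing

StrictInc : List ℤ → Set
StrictInc []             = ⊤
StrictInc (a ∷ [])       = ⊤
StrictInc (a ∷ b ∷ rest) = a ℤ.< b × StrictInc (b ∷ rest)

NonEmpty : {A : Set} → List A → Set
NonEmpty []      = Data.Empty.⊥ where import Data.Empty
NonEmpty (_ ∷ _) = ⊤

-- semistandard set-valued tableau of shape λ/μ (μ = [] for straight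
-- shapes) with max T(r,c) ≤ φ_r, and all entries positive if pos = true
SSVT : List ℕ → List ℕ → List ℤ → Bool → Tab → Set
SSVT la mu phi pos Tb =
  length Tb ≡ length la
  × ((r : ℕ) (row : List Cell) → at Tb r ≡ just row →
       length row ≡ part la r ∸ part mu r)
  × ((r c : ℕ) (C : Cell) → cellAt Tb mu r c ≡ just C →
       NonEmpty C
       × StrictInc (map key C)
       × ((f : ℤ) → at phi r ≡ just f → All (λ e → key e ℤ.≤ f) C)
       × (T pos → All (λ e → ℤ.0ℤ ℤ.< key e) C))
  × ((r c : ℕ) (C D : Cell) → cellAt Tb mu r c ≡ just C →
       cellAt Tb mu r (suc c) ≡ just D →
       All (λ e → All (λ e' → key e ℤ.≤ key e') D) C)
  × ((r c : ℕ) (C D : Cell) → cellAt Tb mu r c ≡ just C →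
       cellAt Tb mu (suc r) c ≡ just D →
       All (λ e → All (λ e' → key e ℤ.< key e') D) C)

-- Monomials β^a ∏ x_i ∏ y_j (x and y parts as multisets) with signs

record Mono : Set where
  constructor mono
  field
    bdeg : ℕ
    xs   : List ℤ
    ys   : List ℤ
open Mono public

_≈M_ : Mono → Mono → Set
m ≈M m' = bdeg m ≡ bdeg m' × xs m ↭ xs m' × ys m ↭ ys m'

STerm : Set
STerm = Mono × ℤ

oneT : STerm
oneT = mono 0 [] [] , ℤ.1ℤ

_⊗_ : STerm → STerm → STerm
(mono a x y , s) ⊗ (mono a' x' y' , s') = mono (a ℕ.+ a') (x ++ x') (y ++ y') , s ℤ.* s'

negPow : ℕ → ℤ
negPow zero    = ℤ.1ℤ
negPow (suc n) = ℤ.- negPow n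

-- d = c - r
entryTerm : ℤ → Entry → STerm
entryTerm d (i , true  , n) = mono (suc n) (i ∷ []) (replicate n (i ℤ.+ d)) , negPow n
entryTerm d (i , false , n) = mono (suc n) [] (replicate (suc n) (i ℤ.+ d)) , ℤ.- negPow n

-- the factor β^{-1} per cell (from β^{-|λ/μ|})
cellTerm : ℤ → Cell → STerm
cellTerm d C with foldr _⊗_ oneT (map (entryTerm d) C)
... | (mono a x y , s) = mono (a ∸ 1) x y , s

rowTerm : ℕ → ℕ → List Cell → STerm
rowTerm r c []       = oneT
rowTerm r c (C ∷ Cs) = cellTerm (+ c ℤ.- + r) C ⊗ rowTerm r (suc c) Cs

tabTerm' : List ℕ → ℕ → Tab → STerm
tabTerm' mu r []           = oneT
tabTerm' mu r (row ∷ rows) = rowTerm r (suc (part mu r)) row ⊗ tabTerm' mu (suc r) rows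

tabTerm : List ℕ → Tab → STerm
tabTerm mu Tb = tabTerm' mu 1 Tb

-- Coefficient of a monomial in a locally finite sum of signed monomials:
-- HasCoeff P t m c  says that the indices i with P i and monomial ≈ m
-- form a finite set L and c is the sum of their signs.

sumℤ : List ℤ → ℤ
sumℤ = foldr ℤ._+_ ℤ.0ℤ

HasCoeff : {I : Set} → (I → Set) → (I → STerm) → Mono → ℤ → Set
HasCoeff {I} P t m c =
  Σ (List I) λ L →
    Unique L
    × All P L
    × All (λ i → proj₁ (t i) ≈M m) L
    × ((i : I) → P i → proj₁ (t i) ≈M m → i ∈ L)
    × c ≡ sumℤ (map (λ i → proj₂ (t i)) L)

LHSValid : List ℕ → List ℤ → Tab → Set
LHSValid la phi Tb = SSVT la [] phi false Tb

LHSTerm : Tab → STerm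
LHSTerm Tb = tabTerm [] Tb

RIdx : Set
RIdx = List ℕ × List ℕ × Tab × Tab

RHSValid : List ℕ → List ℤ → RIdx → Set
RHSValid la phi (nu , mu , T1 , T2) =
  IsPartition nu × nu ⊆P la
  × IsPartition mu × mu ⊆P nu × Disconnected nu mu
  × SSVT nu [] (flagMinus phi) false T1
  × SSVT la mu phi true T2

RHSTerm : RIdx → STerm
RHSTerm (nu , mu , T1 , T2) =
  (mono (size nu ∸ size mu) [] [] , ℤ.1ℤ) ⊗ (tabTerm [] T1 ⊗ tabTerm mu T2)

-- A tableau T of shape λ splits, cell by cell, into its entries ≤ 0 and its entries > 0. The cells
-- containing an entry ≤ 0 form a partition ν ⊆ λ and carry a tableau bounded by φ⁻; the cells
-- containing an entry > 0 form λ/μ, where μ ⊆ ν consists of the cells all of whose entries are ≤ 0.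
-- The mixed cells ν/μ form a disconnected shape, because a positive entry can lie neither weakly
-- left of nor strictly above a nonpositive one; conversely any such pair of tableaux glues back.
-- Each cell carries a factor β⁻¹, so splitting a mixed cell produces one factor β, whence
-- β^{|ν|-|μ|}. Since only finitely many tableaux have a given monomial, the bijection identifies
-- the coefficients of both sides monomial by monomial.

module Submission where

open import Defs

open import Algebra.Bundles using (CommutativeMonoid)
open import Algebra.Structures using (IsCommutativeMonoid)
open import Level using (0ℓ)
open import Data.Bool as Bool using (Bool; true; false; T; if_then_else_)
import Data.Bool.Properties as Boolₚ
open import Function.Bundles using (Equivalence)
open import Data.Empty using (⊥; ⊥-elim)
open import Data.Unit using (tt)
open import Data.Maybe using (just; nothing; fromMaybe)
open import Data.Nat using (ℕ; zero; suc; _+_; _∸_; _≤_; _<_; _<ᵇ_; z≤n; s≤s; z<s; s<s; _≟_; _<?_; _≤?_)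
open import Data.Nat.Properties
open import Data.Integer as ℤ using (ℤ; 0ℤ)
import Data.Integer.Properties as ℤₚ
open import Data.Product as Product using (Σ; _×_; _,_; proj₁; proj₂)
import Data.Product.Properties as Productₚ
open import Data.List using (List; []; _∷_; _++_; map; length; filter; foldr; concatMap; deduplicate)
import Data.List.Properties as List
open import Data.List.Relation.Unary.All as All using (All; []; _∷_)
import Data.List.Relation.Unary.All.Properties as All
open import Data.List.Relation.Unary.Any as Any using (Any; here; there)
import Data.List.Relation.Unary.Any.Properties as Any
open import Data.List.Relation.Unary.AllPairs as AllPairs using (AllPairs; []; _∷_)
import Data.List.Relation.Unary.AllPairs.Properties as AllPairs
open import Data.List.Relation.Unary.Unique.Propositional using (Unique)
import Data.List.Relation.Unary.Unique.DecPropositional.Properties as Unique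
open import Data.List.Membership.Propositional using (_∈_)
import Data.List.Membership.Propositional.Properties as ∈
import Data.List.Membership.DecPropositional as DecMembership
open import Data.List.Relation.Binary.Permutation.Propositional
  using (_↭_; ↭-refl; ↭-reflexive; ↭-sym; ↭-trans; prep)
import Data.List.Relation.Binary.Permutation.Propositional.Properties as ↭
open import Relation.Binary.PropositionalEquality
  using (_≡_; refl; sym; trans; cong; cong₂; subst; module ≡-Reasoning)
import Relation.Binary.Reasoning.Setoid
open import Relation.Binary.Definitions using (DecidableEquality)
open import Function using (_∘_; case_of_)
open import Relation.Nullary using (Dec; yes; no; ¬_)
open import Relation.Nullary.Decidable using (_×-dec_; _→-dec_)

infix 4 _≈T_
_≈T_ : STerm → STerm → Set
t ≈T u = proj₁ t ≈M proj₁ u × proj₂ t ≡ proj₂ u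

≡⇒≈T : {t u : STerm} → t ≡ u → t ≈T u
≡⇒≈T refl = (refl , ↭-refl , ↭-refl) , refl

⊗-isCommutativeMonoid : IsCommutativeMonoid _≈T_ _⊗_ oneT
⊗-isCommutativeMonoid = record
  { isMonoid = record
    { isSemigroup = record
      { isMagma = record
        { isEquivalence = record
          { refl  = ≡⇒≈T refl
          ; sym   = λ { ((a , b , c) , d) → (sym a , ↭-sym b , ↭-sym c) , sym d }
          ; trans = λ { ((a , b , c) , d) ((a′ , b′ , c′) , d′) →
                          (trans a a′ , ↭-trans b b′ , ↭-trans c c′) , trans d d′ }
          }
        ; ∙-cong = λ { ((a , b , c) , d) ((a′ , b′ , c′) , d′) →
                         (cong₂ _+_ a a′ , ↭.++⁺ b b′ , ↭.++⁺ c c′) , cong₂ ℤ._*_ d d′ }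
        }
      ; assoc = λ t u v →
          (+-assoc (bdeg (proj₁ t)) _ _ , ↭-reflexive (List.++-assoc (xs (proj₁ t)) _ _)
          , ↭-reflexive (List.++-assoc (ys (proj₁ t)) _ _)) , ℤₚ.*-assoc (proj₂ t) _ _
      }
    ; identity = (λ t → ≡⇒≈T (cong (proj₁ t ,_) (ℤₚ.*-identityˡ (proj₂ t))))
               , (λ t → (+-identityʳ _ , ↭-reflexive (List.++-identityʳ _) , ↭-reflexive (List.++-identityʳ _))
                        , ℤₚ.*-identityʳ (proj₂ t))
    }
  ; comm = λ t u →
      (+-comm (bdeg (proj₁ t)) _ , ↭.++-comm (xs (proj₁ t)) _ , ↭.++-comm (ys (proj₁ t)) _)
      , ℤₚ.*-comm (proj₂ t) _
  }

termMonoid : CommutativeMonoid 0ℓ 0ℓ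
termMonoid = record { isCommutativeMonoid = ⊗-isCommutativeMonoid }

open CommutativeMonoid termMonoid public
  using (commutativeSemigroup)
  renaming (setoid to termSetoid; refl to ≈T-refl; sym to ≈T-sym; trans to ≈T-trans; ∙-cong to ⊗-cong
           ; assoc to ⊗-assoc; comm to ⊗-comm; identityˡ to ⊗-identityˡ; identityʳ to ⊗-identityʳ)
open import Algebra.Properties.CommutativeSemigroup commutativeSemigroup
  using (interchange; x∙yz≈y∙xz)
open import Algebra.Properties.CommutativeSemigroup +-commutativeSemigroup
  using () renaming (interchange to +-interchange)
module ≈-Reasoning = Relation.Binary.Reasoning.Setoid termSetoid

∏ : List STerm → STerm
∏ = foldr _⊗_ oneT

∏-++ : ∀ p q → ∏ (p ++ q) ≈T ∏ p ⊗ ∏ q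
∏-++ []      q = ≈T-sym (⊗-identityˡ (∏ q))
∏-++ (t ∷ p) q = begin
  t ⊗ ∏ (p ++ q)    ≈⟨ ⊗-cong (≈T-refl {t}) (∏-++ p q) ⟩
  t ⊗ (∏ p ⊗ ∏ q)   ≈⟨ ⊗-assoc t (∏ p) (∏ q) ⟨
  (t ⊗ ∏ p) ⊗ ∏ q   ∎
  where open ≈-Reasoning

module _ {A : Set} (_≟_ : DecidableEquality A) where
  open DecMembership _≟_ using (_∈?_)

  ↭-dec : (p q : List A) → Dec (p ↭ q)
  ↭-dec []      []      = yes ↭-refl
  ↭-dec []      (y ∷ q) = no λ e → case ↭.↭-empty-inv (↭-sym e) of λ ()
  ↭-dec (x ∷ p) q with x ∈? q
  ... | no x∉q  = no λ e → x∉q (↭.∈-resp-↭ e (here refl))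
  ... | yes x∈q with ∈.∈-∃++ x∈q
  ... | ws , zs , refl with ↭-dec p (ws ++ zs)
  ... | yes e = yes (↭-trans (prep x e) (↭-sym (↭.shift x ws zs)))
  ... | no ¬e = no λ e → ¬e (↭.drop-mid [] ws e)

≈M-dec : (m m′ : Mono) → Dec (m ≈M m′)
≈M-dec m m′ = (bdeg m ≟ bdeg m′) ×-dec (↭-dec ℤ._≟_ (xs m) (xs m′) ×-dec ↭-dec ℤ._≟_ (ys m) (ys m′))

≈M-sym : {m m′ : Mono} → m ≈M m′ → m′ ≈M m
≈M-sym (a , b , c) = sym a , ↭-sym b , ↭-sym c

≈M-trans : {m m′ m″ : Mono} → m ≈M m′ → m′ ≈M m″ → m ≈M m″
≈M-trans (a , b , c) (a′ , b′ , c′) = trans a a′ , ↭-trans b b′ , ↭-trans c c′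

coefficient-from-candidates : {I : Set} → DecidableEquality I →
  (P : I → Set) → ((i : I) → Dec (P i)) → (t : I → STerm) (m : Mono) (candidates : List I) →
  ((i : I) → P i → proj₁ (t i) ≈M m → i ∈ candidates) →
  Σ ℤ (HasCoeff P t m)
coefficient-from-candidates {I} _≟_ P P? t m candidates complete =
  _ , L , Unique.deduplicate-! _≟_ selected
    , All.tabulate (proj₁ ∘ selected⁻) , All.tabulate (proj₂ ∘ selected⁻)
    , (λ i p e → ∈.∈-deduplicate⁺ _≟_ (∈.∈-filter⁺ Q? (complete i p e) (p , e))) , refl
  where
  Q? : (i : I) → Dec (P i × proj₁ (t i) ≈M m)
  Q? i = P? i ×-dec ≈M-dec (proj₁ (t i)) m
  selected = filter Q? candidates
  L = deduplicate _≟_ selected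
  selected⁻ : ∀ {i} → i ∈ L → P i × proj₁ (t i) ≈M m
  selected⁻ k = proj₂ (∈.∈-filter⁻ Q? {xs = candidates} (∈.∈-deduplicate⁻ _≟_ selected k))

module _ {I J : Set} {P : I → Set} {Q : J → Set} {t : I → STerm} {u : J → STerm}
  (f : I → J) (g : J → I) (f-valid : ∀ {i} → P i → Q (f i)) (g-valid : ∀ {j} → Q j → P (g j))
  (g∘f : ∀ {i} → P i → g (f i) ≡ i) (f∘g : ∀ {j} → Q j → f (g j) ≡ j)
  (f-term : ∀ {i} → P i → t i ≈T u (f i)) where

  HasCoeff-bijection : ∀ {m c} → HasCoeff P t m c → HasCoeff Q u m c
  HasCoeff-bijection {m} (L , unique , valid , monomial , complete , refl) =
    map f L , unique-map unique valid , All.map⁺ (All.map f-valid valid)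
    , All.map⁺ (All.zipWith (λ (p , e) → ≈M-trans (≈M-sym (proj₁ (f-term p))) e) (valid , monomial))
    , complete′ , cong sumℤ (trans (List.map-cong-local (All.map (proj₂ ∘ f-term) valid)) (List.map-∘ L))
    where
    f-injective : ∀ {i i′} → P i → P i′ → f i ≡ f i′ → i ≡ i′
    f-injective p p′ e = trans (sym (g∘f p)) (trans (cong g e) (g∘f p′))
    unique-map : ∀ {K} → Unique K → All P K → Unique (map f K)
    unique-map []         []         = []
    unique-map (≢s ∷ uK) (p ∷ ps) =
      All.map⁺ (All.zipWith (λ (≢ , q) → ≢ ∘ f-injective p q) (≢s , ps)) ∷ unique-map uK ps
    complete′ : ∀ j → Q j → proj₁ (u j) ≈M m → j ∈ map f L
    complete′ j q e = subst (_∈ map f L) (f∘g q) (∈.∈-map⁺ f (complete (g j) (g-valid q) (≈M-trans gj≈j e)))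
      where
      gj≈j : proj₁ (t (g j)) ≈M proj₁ (u j)
      gj≈j = proj₁ (subst (λ k → t (g j) ≈T u k) (f∘g q) (f-term (g-valid q)))

range : ℕ → ℕ → List ℕ
range s zero    = []
range s (suc n) = s ∷ range (suc s) n

length-map-range : {A : Set} (g : ℕ → A) (s n : ℕ) → length (map g (range s n)) ≡ n
length-map-range g s zero    = refl
length-map-range g s (suc n) = cong suc (length-map-range g (suc s) n)

nth-map-range : {A : Set} (g : ℕ → A) (s n j : ℕ) → j < n → nth (map g (range s n)) j ≡ just (g (s + j))
nth-map-range g s (suc n) zero    _         = cong (just ∘ g) (sym (+-identityʳ s))
nth-map-range g s (suc n) (suc j) (s≤s j<n) =
  trans (nth-map-range g (suc s) n j j<n) (cong (just ∘ g) (sym (+-suc s j)))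

nth-map-range⁻ : {A : Set} (g : ℕ → A) (s n j : ℕ) {x : A} →
  nth (map g (range s n)) j ≡ just x → j < n × x ≡ g (s + j)
nth-map-range⁻ g s (suc n) zero    refl = z<s , cong g (sym (+-identityʳ s))
nth-map-range⁻ g s (suc n) (suc j) e    with nth-map-range⁻ g (suc s) n j e
... | j<n , refl = s<s j<n , cong g (sym (+-suc s j))

map-range-cong : {A : Set} (g h : ℕ → A) (s n : ℕ) →
  (∀ j → j < n → g (s + j) ≡ h (s + j)) → map g (range s n) ≡ map h (range s n)
map-range-cong g h s zero    eq = refl
map-range-cong g h s (suc n) eq = cong₂ _∷_
  (subst (λ k → g k ≡ h k) (+-identityʳ s) (eq 0 z<s))
  (map-range-cong g h (suc s) n λ j j<n → subst (λ k → g k ≡ h k) (+-suc s j) (eq (suc j) (s<s j<n)))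

≡-map-range : {A : Set} (p : List A) (g : ℕ → A) (s : ℕ) →
  (∀ j x → nth p j ≡ just x → x ≡ g (s + j)) → p ≡ map g (range s (length p))
≡-map-range []      g s h = refl
≡-map-range (x ∷ p) g s h = cong₂ _∷_ (trans (h 0 x refl) (cong g (+-identityʳ s)))
  (≡-map-range p g (suc s) λ j y e → trans (h (suc j) y e) (cong g (+-suc s j)))

tabulateRow : List ℕ → List ℕ → (ℕ → ℕ → Cell) → ℕ → List Cell
tabulateRow la mu f r = map (f r) (range (suc (part mu r)) (part la r ∸ part mu r))

tabulateTab : List ℕ → List ℕ → (ℕ → ℕ → Cell) → Tab
tabulateTab la mu f = map (tabulateRow la mu f) (range 1 (length la))

cellOf : Tab → List ℕ → ℕ → ℕ → Cell
cellOf Tb mu r c = fromMaybe [] (cellAt Tb mu r c)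

-- InSkew without its condition 1 ≤ r, which is automatic as part la 0 = 0
Inside : List ℕ → List ℕ → ℕ → ℕ → Set
Inside la mu r c = part mu r < c × c ≤ part la r

Inside? : (la mu : List ℕ) (r c : ℕ) → Dec (Inside la mu r c)
Inside? la mu r c = (part mu r <? c) ×-dec (c ≤? part la r)

part-[] : (r : ℕ) → part [] r ≡ 0
part-[] zero    = refl
part-[] (suc r) = refl

tabulateRow-[] : (la : List ℕ) (g : ℕ → ℕ → Cell) (r : ℕ) →
  tabulateRow la [] g r ≡ map (g r) (range 1 (part la r))
tabulateRow-[] la g r rewrite part-[] r = refl

Inside-[] : (la : List ℕ) (r : ℕ) {c : ℕ} → 0 < c → c ≤ part la r → Inside la [] r c
Inside-[] la r 0<c c≤λ = subst (_< _) (sym (part-[] r)) 0<c , c≤λ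

Inside-[]⁻ : (la : List ℕ) (r : ℕ) {c : ℕ} → Inside la [] r c → 0 < c
Inside-[]⁻ la r (0<c , _) = subst (_< _) (part-[] r) 0<c

nth-length : {A : Set} (p : List A) (j : ℕ) {x : A} → nth p j ≡ just x → j < length p
nth-length (_ ∷ p) zero    e = z<s
nth-length (_ ∷ p) (suc j) e = s<s (nth-length p j e)

nth-beyond : {A : Set} (p : List A) (k : ℕ) → length p ≤ k → nth p k ≡ nothing
nth-beyond []      k       _         = refl
nth-beyond (x ∷ p) (suc k) (s≤s ℓ≤k) = nth-beyond p k ℓ≤k

nth-total : {A : Set} (p : List A) (j : ℕ) → j < length p → Σ A λ x → nth p j ≡ just x
nth-total (x ∷ p) zero    _         = x , refl
nth-total (x ∷ p) (suc j) (s≤s j<n) = nth-total p j j<n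

0<part⇒row : (la : List ℕ) (r : ℕ) → 0 < part la r → Σ ℕ λ k → r ≡ suc k × k < length la
0<part⇒row la (suc k) 0<λ = k , refl , go la k 0<λ
  where
  go : (l : List ℕ) (k : ℕ) → 0 < fromMaybe 0 (nth l k) → k < length l
  go (x ∷ l) zero    _   = z<s
  go (x ∷ l) (suc k) 0<λ = s<s (go l k 0<λ)

<∸⇒suc+≤ : ∀ m j l → j < l ∸ m → suc m + j ≤ l
<∸⇒suc+≤ zero    j l       j<l = j<l
<∸⇒suc+≤ (suc m) j (suc l) j<l = s≤s (<∸⇒suc+≤ m j l j<l)

∸-suc-< : ∀ {m c l} → m < c → c ≤ l → c ∸ suc m < l ∸ m
∸-suc-< {zero}  (s≤s _)   (s≤s c≤l) = s≤s c≤l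
∸-suc-< {suc m} (s≤s m<c) (s≤s c≤l) = ∸-suc-< m<c c≤l

cellAt-just : (Tb : Tab) (mu : List ℕ) (r c : ℕ) {row : List Cell} → at Tb r ≡ just row →
  cellAt Tb mu r c ≡ (if part mu r <ᵇ c then nth row (c ∸ suc (part mu r)) else nothing)
cellAt-just Tb mu r c e rewrite e = refl

cellAt-tabulateTab : (la mu : List ℕ) (f : ℕ → ℕ → Cell) (r c : ℕ) → Inside la mu r c →
  cellAt (tabulateTab la mu f) mu r c ≡ just (f r c)
cellAt-tabulateTab la mu f r c (μ<c , c≤λ)
  with 0<part⇒row la r (<-≤-trans (≤-<-trans z≤n μ<c) c≤λ)
... | k , refl , k<ℓ
  rewrite cellAt-just (tabulateTab la mu f) mu (suc k) c (nth-map-range (tabulateRow la mu f) 1 (length la) k k<ℓ)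
        | Equivalence.to Boolₚ.T-≡ (<⇒<ᵇ μ<c) =
  trans (nth-map-range (f (suc k)) _ _ (c ∸ suc (part mu (suc k))) (∸-suc-< μ<c c≤λ))
        (cong (just ∘ f (suc k)) (m+[n∸m]≡n μ<c))

cellAt-tabulateTab⁻ : (la mu : List ℕ) (f : ℕ → ℕ → Cell) (r c : ℕ) {C : Cell} →
  cellAt (tabulateTab la mu f) mu r c ≡ just C → Inside la mu r c × C ≡ f r c
cellAt-tabulateTab⁻ la mu f (suc k) c {C} e with nth (tabulateTab la mu f) k in row-k
... | just row with part mu (suc k) <ᵇ c in lt
... | true with nth-map-range⁻ (tabulateRow la mu f) 1 (length la) k row-k
... | _ , refl with nth-map-range⁻ (f (suc k)) (suc (part mu (suc k))) _ (c ∸ suc (part mu (suc k))) e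
... | j<n , C≡ = (μ<c , subst (_≤ part la (suc k)) μ+[c∸μ]≡c (<∸⇒suc+≤ _ _ _ j<n))
                , trans C≡ (cong (f (suc k)) μ+[c∸μ]≡c)
  where
  μ<c : part mu (suc k) < c
  μ<c = <ᵇ⇒< _ c (subst T (sym lt) tt)
  μ+[c∸μ]≡c = m+[n∸m]≡n μ<c

≡-tabulateTab : (Tb : Tab) (la mu : List ℕ) → length Tb ≡ length la →
  (∀ r row → at Tb r ≡ just row → length row ≡ part la r ∸ part mu r) →
  Tb ≡ tabulateTab la mu (cellOf Tb mu)
≡-tabulateTab Tb la mu ℓ≡ rowℓ≡ =
  trans (≡-map-range Tb (tabulateRow la mu (cellOf Tb mu)) 1 row≡)
        (cong (map (tabulateRow la mu (cellOf Tb mu)) ∘ range 1) ℓ≡)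
  where
  row≡ : ∀ j row → nth Tb j ≡ just row → row ≡ tabulateRow la mu (cellOf Tb mu) (suc j)
  row≡ j row e = trans (≡-map-range row (cellOf Tb mu (suc j)) (suc μ) cell≡)
                       (cong (map (cellOf Tb mu (suc j)) ∘ range (suc μ)) (rowℓ≡ (suc j) row e))
    where
    μ = part mu (suc j)
    cell≡ : ∀ i x → nth row i ≡ just x → x ≡ cellOf Tb mu (suc j) (suc μ + i)
    cell≡ i x e′ rewrite cellAt-just Tb mu (suc j) (suc μ + i) e
                       | Equivalence.to Boolₚ.T-≡ (<⇒<ᵇ (s≤s (m≤m+n μ i)))
                       | m+n∸m≡n (suc μ) i
                       | e′ = refl

tabulateTab-cong : (la mu : List ℕ) (f g : ℕ → ℕ → Cell) →
  (∀ r c → Inside la mu r c → f r c ≡ g r c) → tabulateTab la mu f ≡ tabulateTab la mu g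
tabulateTab-cong la mu f g f≡g = map-range-cong (tabulateRow la mu f) (tabulateRow la mu g) 1 (length la) λ j _ →
  map-range-cong (f (suc j)) (g (suc j)) _ _ λ i i<n →
    f≡g (suc j) _ (s≤s (m≤m+n _ i) , <∸⇒suc+≤ _ i _ i<n)

Increasing : Cell → Set
Increasing = AllPairs (λ e e′ → key e ℤ.< key e′)

StrictInc⇒Increasing : (C : Cell) → StrictInc (map key C) → Increasing C
StrictInc⇒Increasing []           _        = []
StrictInc⇒Increasing (e ∷ [])     _        = [] ∷ []
StrictInc⇒Increasing (e ∷ e′ ∷ C) (lt , s) with StrictInc⇒Increasing (e′ ∷ C) s
... | e′< ∷ inc = (lt ∷ All.map (ℤₚ.<-trans lt) e′<) ∷ e′< ∷ inc

Increasing⇒StrictInc : (C : Cell) → Increasing C → StrictInc (map key C)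
Increasing⇒StrictInc []           _                = tt
Increasing⇒StrictInc (e ∷ [])     _                = tt
Increasing⇒StrictInc (e ∷ e′ ∷ C) ((lt ∷ _) ∷ inc) = lt , Increasing⇒StrictInc (e′ ∷ C) inc

IsLow : Entry → Set
IsLow e = key e ℤ.≤ 0ℤ

IsHigh : Entry → Set
IsHigh e = 0ℤ ℤ.< key e

low? : (e : Entry) → Dec (IsLow e)
low? e = key e ℤ.≤? 0ℤ

high? : (e : Entry) → Dec (IsHigh e)
high? e = 0ℤ ℤ.<? key e

lower upper : Cell → Cell
lower = filter low?
upper = filter high?

HasLow AllLow : Cell → Set
HasLow = Any IsLow
AllLow = All IsLow

HasLow? : (C : Cell) → Dec (HasLow C)
HasLow? = Any.any? low?

AllLow? : (C : Cell) → Dec (AllLow C)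
AllLow? = All.all? low?

lower++upper : (C : Cell) → Increasing C → lower C ++ upper C ≡ C
lower++upper []      _           = refl
lower++upper (e ∷ C) (e< ∷ inc) = split (low? e)
  where
  split : Dec (IsLow e) → lower (e ∷ C) ++ upper (e ∷ C) ≡ e ∷ C
  split (yes e≤0) = trans (cong₂ _++_ (List.filter-accept low? e≤0) (List.filter-reject high? (ℤₚ.≤⇒≯ e≤0)))
                          (cong (e ∷_) (lower++upper C inc))
  split (no e≰0)  = cong₂ _++_
    (List.filter-none low? (e≰0 ∷ All.map (λ e<e′ e′≤0 → e≰0 (ℤₚ.<⇒≤ (ℤₚ.<-≤-trans e<e′ e′≤0))) e<))
    (List.filter-all high? (0<e ∷ All.map (ℤₚ.<-trans 0<e) e<))
    where 0<e = ℤₚ.≰⇒> e≰0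

lower-++ : (C D : Cell) → AllLow C → All IsHigh D → lower (C ++ D) ≡ C
lower-++ C D low high = begin
  lower (C ++ D)       ≡⟨ List.filter-++ low? C D ⟩
  lower C ++ lower D   ≡⟨ cong₂ _++_ (List.filter-all low? low) (List.filter-none low? (All.map ℤₚ.<⇒≱ high)) ⟩
  C ++ []              ≡⟨ List.++-identityʳ C ⟩
  C                    ∎
  where open ≡-Reasoning

upper-++ : (C D : Cell) → AllLow C → All IsHigh D → upper (C ++ D) ≡ D
upper-++ C D low high = begin
  upper (C ++ D)       ≡⟨ List.filter-++ high? C D ⟩
  upper C ++ upper D   ≡⟨ cong₂ _++_ (List.filter-none high? (All.map ℤₚ.≤⇒≯ low)) (List.filter-all high? high) ⟩
  D                    ∎
  where open ≡-Reasoning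

lower-AllLow : (C : Cell) → AllLow (lower C)
lower-AllLow = All.all-filter low?

upper-AllHigh : (C : Cell) → All IsHigh (upper C)
upper-AllHigh = All.all-filter high?

lower-nonempty : (C : Cell) → HasLow C → NonEmpty (lower C)
lower-nonempty C low with lower C | List.filter-some low? low
... | _ ∷ _ | _ = tt

¬AllLow⇒AnyHigh : (C : Cell) → ¬ AllLow C → Any IsHigh C
¬AllLow⇒AnyHigh []      ¬low = ⊥-elim (¬low [])
¬AllLow⇒AnyHigh (e ∷ C) ¬low with low? e
... | yes e≤0 = there (¬AllLow⇒AnyHigh C (¬low ∘ (e≤0 ∷_)))
... | no  e≰0 = here (ℤₚ.≰⇒> e≰0)

upper-nonempty : (C : Cell) → ¬ AllLow C → NonEmpty (upper C)
upper-nonempty C ¬low with upper C | List.filter-some high? (¬AllLow⇒AnyHigh C ¬low)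
... | _ ∷ _ | _ = tt

lower-empty : (C : Cell) → ¬ HasLow C → lower C ≡ []
lower-empty C ¬low = List.filter-none low? (All.¬Any⇒All¬ C ¬low)

upper-empty : (C : Cell) → AllLow C → upper C ≡ []
upper-empty C low = List.filter-none high? (All.map ℤₚ.≤⇒≯ low)

AllHigh⇒¬HasLow : ∀ {D} → All IsHigh D → ¬ HasLow D
AllHigh⇒¬HasLow (0<d ∷ _)  (here d≤0)  = ℤₚ.<⇒≱ 0<d d≤0
AllHigh⇒¬HasLow (_ ∷ high) (there low) = AllHigh⇒¬HasLow high low

AllHigh⇒¬AllLow : ∀ {D} → NonEmpty D → All IsHigh D → ¬ AllLow D
AllHigh⇒¬AllLow {d ∷ _} _ (0<d ∷ _) (d≤0 ∷ _) = ℤₚ.<⇒≱ 0<d d≤0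

lower-All : {P : Entry → Set} (C : Cell) → All P C → All P (lower C)
lower-All C = All.filter⁺ low?

upper-All : {P : Entry → Set} (C : Cell) → All P C → All P (upper C)
upper-All C = All.filter⁺ high?

infix 4 _≤ᶜ_ _<ᶜ_
_≤ᶜ_ _<ᶜ_ : Cell → Cell → Set
C ≤ᶜ D = All (λ e → All (λ e′ → key e ℤ.≤ key e′) D) C
C <ᶜ D = All (λ e → All (λ e′ → key e ℤ.< key e′) D) C

ValidCell : List ℤ → Bool → ℕ → Cell → Set
ValidCell phi pos r C = NonEmpty C × Increasing C
  × ((f : ℤ) → at phi r ≡ just f → All (λ e → key e ℤ.≤ f) C)
  × (T pos → All IsHigh C)

record CellwiseSSVT (la mu : List ℕ) (phi : List ℤ) (pos : Bool) (f : ℕ → ℕ → Cell) : Set where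
  field
    valid-cell    : ∀ r c → Inside la mu r c → ValidCell phi pos r (f r c)
    row-weak      : ∀ r c → Inside la mu r c → Inside la mu r (suc c) → f r c ≤ᶜ f r (suc c)
    column-strict : ∀ r c → Inside la mu r c → Inside la mu (suc r) c → f r c <ᶜ f (suc r) c
open CellwiseSSVT public

CellwiseSSVT⇒SSVT : ∀ la mu phi pos f → CellwiseSSVT la mu phi pos f → SSVT la mu phi pos (tabulateTab la mu f)
CellwiseSSVT⇒SSVT la mu phi pos f ssvt =
  length-map-range (tabulateRow la mu f) 1 (length la) , rowLength , cells , rows , columns
  where
  rowLength : ∀ r row → at (tabulateTab la mu f) r ≡ just row → length row ≡ part la r ∸ part mu r
  rowLength (suc k) row e with nth-map-range⁻ (tabulateRow la mu f) 1 (length la) k e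
  ... | _ , refl = length-map-range (f (suc k)) _ _
  cells : ∀ r c C → cellAt (tabulateTab la mu f) mu r c ≡ just C →
    NonEmpty C × StrictInc (map key C) × ((b : ℤ) → at phi r ≡ just b → All (λ e → key e ℤ.≤ b) C)
    × (T pos → All IsHigh C)
  cells r c C e with cellAt-tabulateTab⁻ la mu f r c e
  ... | inside , refl with valid-cell ssvt r c inside
  ... | ne , inc , flag , pos = ne , Increasing⇒StrictInc _ inc , flag , pos
  rows : ∀ r c C D → cellAt (tabulateTab la mu f) mu r c ≡ just C →
    cellAt (tabulateTab la mu f) mu r (suc c) ≡ just D → C ≤ᶜ D
  rows r c C D e e′ with cellAt-tabulateTab⁻ la mu f r c e | cellAt-tabulateTab⁻ la mu f r (suc c) e′
  ... | inside , refl | inside′ , refl = row-weak ssvt r c inside inside′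
  columns : ∀ r c C D → cellAt (tabulateTab la mu f) mu r c ≡ just C →
    cellAt (tabulateTab la mu f) mu (suc r) c ≡ just D → C <ᶜ D
  columns r c C D e e′ with cellAt-tabulateTab⁻ la mu f r c e | cellAt-tabulateTab⁻ la mu f (suc r) c e′
  ... | inside , refl | inside′ , refl = column-strict ssvt r c inside inside′

SSVT⇒≡tabulateTab : ∀ la mu phi pos Tb → SSVT la mu phi pos Tb → Tb ≡ tabulateTab la mu (cellOf Tb mu)
SSVT⇒≡tabulateTab la mu phi pos Tb (ℓ≡ , rowℓ≡ , _) = ≡-tabulateTab Tb la mu ℓ≡ rowℓ≡

SSVT⇒CellwiseSSVT : ∀ la mu phi pos Tb → SSVT la mu phi pos Tb → CellwiseSSVT la mu phi pos (cellOf Tb mu)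
SSVT⇒CellwiseSSVT la mu phi pos Tb v@(_ , _ , cells , rows , columns) = record
  { valid-cell    = λ r c inside → case cells r c _ (cellAt-Inside r c inside) of λ where
                      (ne , inc , flag , pos) → ne , StrictInc⇒Increasing _ inc , flag , pos
  ; row-weak      = λ r c inside inside′ → rows r c _ _ (cellAt-Inside r c inside) (cellAt-Inside r (suc c) inside′)
  ; column-strict = λ r c inside inside′ → columns r c _ _ (cellAt-Inside r c inside) (cellAt-Inside (suc r) c inside′)
  }
  where
  cellAt-Inside : ∀ r c → Inside la mu r c → cellAt Tb mu r c ≡ just (cellOf Tb mu r c)
  cellAt-Inside r c inside =
    trans (cong (λ Tb′ → cellAt Tb′ mu r c) (SSVT⇒≡tabulateTab la mu phi pos Tb v))
          (cellAt-tabulateTab la mu (cellOf Tb mu) r c inside)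

cellOf-tabulateTab : ∀ la mu f r c → Inside la mu r c → cellOf (tabulateTab la mu f) mu r c ≡ f r c
cellOf-tabulateTab la mu f r c inside = cong (fromMaybe []) (cellAt-tabulateTab la mu f r c inside)

cellOf-tabulateTab-outside : ∀ la mu f r c → ¬ Inside la mu r c → cellOf (tabulateTab la mu f) mu r c ≡ []
cellOf-tabulateTab-outside la mu f r c outside with cellAt (tabulateTab la mu f) mu r c in e
... | nothing = refl
... | just C  = ⊥-elim (outside (proj₁ (cellAt-tabulateTab⁻ la mu f r c e)))

IsPartition-tail : ∀ {x a} → IsPartition (x ∷ a) → IsPartition a
IsPartition-tail {a = []}    _           = tt
IsPartition-tail {a = y ∷ a} (_ , _ , p) = p

IsPartition-head : ∀ {x a} → IsPartition (x ∷ a) → 0 < x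
IsPartition-head {a = []}    p           = p
IsPartition-head {a = y ∷ a} (p , _ , _) = p

Antitone : List ℕ → Set
Antitone ns = ∀ k → part ns (suc (suc k)) ≤ part ns (suc k)

IsPartition⇒Antitone : ∀ a → IsPartition a → Antitone a
IsPartition⇒Antitone []          _             k       = z≤n
IsPartition⇒Antitone (x ∷ [])    _             zero    = z≤n
IsPartition⇒Antitone (x ∷ [])    _             (suc k) = z≤n
IsPartition⇒Antitone (x ∷ y ∷ a) (_ , y≤x , _) zero    = y≤x
IsPartition⇒Antitone (x ∷ y ∷ a) (_ , _ , p)   (suc k) = IsPartition⇒Antitone (y ∷ a) p k

IsPartition-unique : ∀ a b → IsPartition a → IsPartition b → (∀ k → part a (suc k) ≡ part b (suc k)) → a ≡ b
IsPartition-unique []      []      _  _  _ = refl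
IsPartition-unique []      (y ∷ b) _  pb e = ⊥-elim (<-irrefl (e 0) (IsPartition-head pb))
IsPartition-unique (x ∷ a) []      pa _  e = ⊥-elim (<-irrefl (sym (e 0)) (IsPartition-head pa))
IsPartition-unique (x ∷ a) (y ∷ b) pa pb e =
  cong₂ _∷_ (e 0) (IsPartition-unique a b (IsPartition-tail pa) (IsPartition-tail pb) (e ∘ suc))

IsPartition-length-mono : ∀ a b → IsPartition a → (∀ k → part a (suc k) ≤ part b (suc k)) → length a ≤ length b
IsPartition-length-mono []      b       _  _  = z≤n
IsPartition-length-mono (x ∷ a) []      pa a≤b = ⊥-elim (<-irrefl refl (<-≤-trans (IsPartition-head pa) (a≤b 0)))
IsPartition-length-mono (x ∷ a) (y ∷ b) pa a≤b = s≤s (IsPartition-length-mono a b (IsPartition-tail pa) (a≤b ∘ suc))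

positivePrefix : List ℕ → List ℕ
positivePrefix []           = []
positivePrefix (zero ∷ ns)  = []
positivePrefix (suc n ∷ ns) = suc n ∷ positivePrefix ns

part≤head : ∀ ns → Antitone ns → ∀ k → part ns (suc k) ≤ part ns 1
part≤head ns anti zero    = ≤-refl
part≤head ns anti (suc k) = ≤-trans (anti k) (part≤head ns anti k)

part-positivePrefix : ∀ ns → Antitone ns → ∀ r → part (positivePrefix ns) r ≡ part ns r
part-positivePrefix ns           anti zero          = refl
part-positivePrefix []           anti (suc k)       = refl
part-positivePrefix (zero ∷ ns)  anti (suc k)       = sym (n≤0⇒n≡0 (part≤head (zero ∷ ns) anti k))
part-positivePrefix (suc n ∷ ns) anti (suc zero)    = refl
part-positivePrefix (suc n ∷ ns) anti (suc (suc k)) = part-positivePrefix ns (anti ∘ suc) (suc k)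

positivePrefix-IsPartition : ∀ ns → Antitone ns → IsPartition (positivePrefix ns)
positivePrefix-IsPartition []                    anti = tt
positivePrefix-IsPartition (zero ∷ ns)           anti = tt
positivePrefix-IsPartition (suc n ∷ [])          anti = z<s
positivePrefix-IsPartition (suc n ∷ zero ∷ ns)   anti = z<s
positivePrefix-IsPartition (suc n ∷ suc n′ ∷ ns) anti =
  z<s , anti 0 , positivePrefix-IsPartition (suc n′ ∷ ns) (anti ∘ suc)

≤-fromBelow : ∀ a b → (∀ c → 0 < c → c ≤ a → c ≤ b) → a ≤ b
≤-fromBelow zero    b h = z≤n
≤-fromBelow (suc a) b h = h (suc a) z<s ≤-refl

≡-fromBelow : ∀ a b → (∀ c → 0 < c → c ≤ a → c ≤ b) → (∀ c → 0 < c → c ≤ b → c ≤ a) → a ≡ b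
≡-fromBelow a b h h′ = ≤-antisym (≤-fromBelow a b h) (≤-fromBelow b a h′)

module _ {Q : Cell → Set} (Q? : (C : Cell) → Dec (Q C)) where

  countPrefix : List Cell → ℕ
  countPrefix []        = 0
  countPrefix (C ∷ row) with Q? C
  ... | yes _ = suc (countPrefix row)
  ... | no  _ = 0

  shapeWhere : Tab → List ℕ
  shapeWhere Tb = positivePrefix (map countPrefix Tb)

  private
    LeftClosed : (ℕ → Cell) → ℕ → ℕ → Set
    LeftClosed h s n = ∀ j → suc j < n → Q (h (s + suc j)) → Q (h (s + j))

    Q-first : ∀ h s n → LeftClosed h s n → ∀ j → j < n → Q (h (s + j)) → Q (h (s + 0))
    Q-first h s n closed zero    _   q = q
    Q-first h s n closed (suc j) j<n q = Q-first h s n closed j (<-trans (n<1+n j) j<n) (closed j j<n q)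

  countPrefix-range : ∀ h s n → LeftClosed h s n → ∀ j →
    (j < countPrefix (map h (range s n)) → j < n × Q (h (s + j)))
    × (j < n → Q (h (s + j)) → j < countPrefix (map h (range s n)))
  countPrefix-range h s zero    closed j = (λ ()) , (λ ())
  countPrefix-range h s (suc n) closed j with Q? (h s)
  ... | no ¬q  = (λ ()) , λ j<n q → ⊥-elim (¬q (subst (Q ∘ h) (+-identityʳ s) (Q-first h s (suc n) closed j j<n q)))
  ... | yes q₀ = to j , from j
    where
    shift : ∀ {j} → Q (h (suc s + j)) → Q (h (s + suc j))
    shift = subst (Q ∘ h) (sym (+-suc s _))
    IH : ∀ j → (j < countPrefix (map h (range (suc s) n)) → j < n × Q (h (suc s + j)))
                 × (j < n → Q (h (suc s + j)) → j < countPrefix (map h (range (suc s) n)))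
    IH = countPrefix-range h (suc s) n λ j j<n q → subst (Q ∘ h) (+-suc s j) (closed (suc j) (s<s j<n) (shift q))
    to : ∀ j → j < suc (countPrefix (map h (range (suc s) n))) → j < suc n × Q (h (s + j))
    to zero    _         = z<s , subst (Q ∘ h) (sym (+-identityʳ s)) q₀
    to (suc j) (s≤s j<k) = Product.map s<s shift (proj₁ (IH j) j<k)
    from : ∀ j → j < suc n → Q (h (s + j)) → j < suc (countPrefix (map h (range (suc s) n)))
    from zero    _         _ = z<s
    from (suc j) (s≤s j<n) q = s<s (proj₂ (IH j) j<n (subst (Q ∘ h) (+-suc s j) q))

  part-map-countPrefix : ∀ la g r →
    part (map countPrefix (tabulateTab la [] g)) r ≡ countPrefix (tabulateRow la [] g r)
  part-map-countPrefix la g zero    = refl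
  part-map-countPrefix la g (suc k) with k <? length la
  ... | yes k<ℓ = cong (fromMaybe 0) (trans (cong (λ p → nth p k) (sym (List.map-∘ (range 1 (length la)))))
                                            (nth-map-range (countPrefix ∘ tabulateRow la [] g) 1 (length la) k k<ℓ))
  ... | no  k≮ℓ rewrite nth-beyond la k (≮⇒≥ k≮ℓ) =
    cong (fromMaybe 0) (nth-beyond (map countPrefix (tabulateTab la [] g)) k
      (≤-trans (≤-reflexive (trans (List.length-map countPrefix (tabulateTab la [] g))
                                   (length-map-range (tabulateRow la [] g) 1 (length la))))
               (≮⇒≥ k≮ℓ)))

  module ShapeOf (la : List ℕ) (g : ℕ → ℕ → Cell)
    (closedˡ : ∀ r c → 0 < c → suc c ≤ part la r → Q (g r (suc c)) → Q (g r c))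
    (closedᵘ : ∀ k c → 0 < c → c ≤ part la (suc (suc k)) → Q (g (suc (suc k)) c) →
                 c ≤ part la (suc k) × Q (g (suc k) c)) where

    private
      counts : List ℕ
      counts = map countPrefix (tabulateTab la [] g)

      column : ∀ r j → (suc j ≤ part counts r → suc j ≤ part la r × Q (g r (suc j)))
                     × (suc j ≤ part la r → Q (g r (suc j)) → suc j ≤ part counts r)
      column r j = (λ j<k → proj₁ (row j) (subst (suc j ≤_) counts≡ j<k))
                 , (λ j<λ q → subst (suc j ≤_) (sym counts≡) (proj₂ (row j) j<λ q))
        where
        counts≡ : part counts r ≡ countPrefix (map (g r) (range 1 (part la r)))
        counts≡ = trans (part-map-countPrefix la g r) (cong countPrefix (tabulateRow-[] la g r))
        row : ∀ j → (j < countPrefix (map (g r) (range 1 (part la r))) → j < part la r × Q (g r (suc j)))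
                  × (j < part la r → Q (g r (suc j)) → j < countPrefix (map (g r) (range 1 (part la r))))
        row = countPrefix-range (g r) 1 (part la r) (λ j j<n q → closedˡ r (suc j) z<s j<n q)

      counts⇒ : ∀ r c → 0 < c → c ≤ part counts r → c ≤ part la r × Q (g r c)
      counts⇒ r (suc j) _ = proj₁ (column r j)

      counts⇐ : ∀ r c → 0 < c → c ≤ part la r → Q (g r c) → c ≤ part counts r
      counts⇐ r (suc j) _ = proj₂ (column r j)

      counts-antitone : Antitone counts
      counts-antitone k = ≤-fromBelow _ _ λ c 0<c c≤k →
        let c≤λ , q = counts⇒ (suc (suc k)) c 0<c c≤k
            c≤λ′ , q′ = closedᵘ k c 0<c c≤λ q
        in counts⇐ (suc k) c 0<c c≤λ′ q′

    shape-IsPartition : IsPartition (shapeWhere (tabulateTab la [] g))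
    shape-IsPartition = positivePrefix-IsPartition counts counts-antitone

    shape⇒ : ∀ r c → 0 < c → c ≤ part (shapeWhere (tabulateTab la [] g)) r → c ≤ part la r × Q (g r c)
    shape⇒ r c 0<c c≤ν = counts⇒ r c 0<c (subst (c ≤_) (part-positivePrefix counts counts-antitone r) c≤ν)

    shape⇐ : ∀ r c → 0 < c → c ≤ part la r → Q (g r c) → c ≤ part (shapeWhere (tabulateTab la [] g)) r
    shape⇐ r c 0<c c≤λ q = subst (c ≤_) (sym (part-positivePrefix counts counts-antitone r)) (counts⇐ r c 0<c c≤λ q)

-- Splitting a tableau at 0

shapeν shapeμ : Tab → List ℕ
shapeν = shapeWhere HasLow?
shapeμ = shapeWhere AllLow?

lowerTab : Tab → Tab
lowerTab T = tabulateTab (shapeν T) [] (λ r c → lower (cellOf T [] r c))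

upperTab : List ℕ → Tab → Tab
upperTab la T = tabulateTab la (shapeμ T) (λ r c → upper (cellOf T [] r c))

splitTab : List ℕ → Tab → RIdx
splitTab la T = shapeν T , shapeμ T , lowerTab T , upperTab la T

All≥⇒≤0 : ∀ {k D} → All (λ e → k ℤ.≤ key e) D → HasLow D → k ℤ.≤ 0ℤ
All≥⇒≤0 (k≤d ∷ _)   (here d≤0) = ℤₚ.≤-trans k≤d d≤0
All≥⇒≤0 (_ ∷ k≤ds) (there low) = All≥⇒≤0 k≤ds low

≤ᶜ-HasLow : ∀ {C D} → C ≤ᶜ D → NonEmpty C → HasLow D → HasLow C
≤ᶜ-HasLow {e ∷ C} (e≤D ∷ _) _ low = here (All≥⇒≤0 e≤D low)

≤ᶜ-AllLow : ∀ {C D} → C ≤ᶜ D → NonEmpty D → AllLow D → AllLow C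
≤ᶜ-AllLow {C} {d ∷ D} C≤D _ (d≤0 ∷ _) = All.map (λ { (e≤d ∷ _) → ℤₚ.≤-trans e≤d d≤0 }) C≤D

<ᶜ⇒≤ᶜ : ∀ {C D} → C <ᶜ D → C ≤ᶜ D
<ᶜ⇒≤ᶜ = All.map (All.map ℤₚ.<⇒≤)

≤ᶜ-high-low : ∀ {C D} → C ≤ᶜ D → ¬ AllLow C → HasLow D → ⊥
≤ᶜ-high-low {C} C≤D ¬low low = go C≤D (¬AllLow⇒AnyHigh C ¬low)
  where
  go : ∀ {C} → C ≤ᶜ _ → Any IsHigh C → ⊥
  go (e≤D ∷ _) (here 0<e) = ℤₚ.<⇒≱ 0<e (All≥⇒≤0 e≤D low)
  go (_ ∷ C≤D) (there hi) = go C≤D hi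

AllLow⇒HasLow : ∀ {C} → NonEmpty C → AllLow C → HasLow C
AllLow⇒HasLow {e ∷ C} _ (e≤0 ∷ _) = here e≤0

All²-mono : ∀ {R : Entry → Entry → Set} {C C′ D D′ : Cell} →
  (∀ {P : Entry → Set} → All P C → All P C′) → (∀ {P : Entry → Set} → All P D → All P D′) →
  All (λ e → All (R e) D) C → All (λ e → All (R e) D′) C′
All²-mono C⊆ D⊆ CRD = C⊆ (All.map D⊆ CRD)

at-map⁻ : {A B : Set} (h : A → B) (l : List A) (r : ℕ) {y : B} →
  at (map h l) r ≡ just y → Σ A λ x → at l r ≡ just x × y ≡ h x
at-map⁻ h (x ∷ l) (suc zero)    refl = x , refl , refl
at-map⁻ h (x ∷ l) (suc (suc k)) e    = at-map⁻ h l (suc k) e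

at-map⁺ : {A B : Set} (h : A → B) (l : List A) (r : ℕ) {x : A} → at l r ≡ just x → at (map h l) r ≡ just (h x)
at-map⁺ h (x ∷ l) (suc zero)    refl = refl
at-map⁺ h (x ∷ l) (suc (suc k)) e    = at-map⁺ h l (suc k) e

module SplitTableau (la : List ℕ) (phi : List ℤ) (la-partition : IsPartition la)
  (T : Tab) (v : SSVT la [] phi false T) where

  cell : ℕ → ℕ → Cell
  cell = cellOf T []

  cellwise : CellwiseSSVT la [] phi false cell
  cellwise = SSVT⇒CellwiseSSVT la [] phi false T v

  T≡ : T ≡ tabulateTab la [] cell
  T≡ = SSVT⇒≡tabulateTab la [] phi false T v

  antitone : Antitone la
  antitone = IsPartition⇒Antitone la la-partition

  nonempty : ∀ r c → 0 < c → c ≤ part la r → NonEmpty (cell r c)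
  nonempty r c 0<c c≤λ = proj₁ (valid-cell cellwise r c (Inside-[] la r 0<c c≤λ))

  weak : ∀ r c → 0 < c → suc c ≤ part la r → cell r c ≤ᶜ cell r (suc c)
  weak r c 0<c c<λ = row-weak cellwise r c (Inside-[] la r 0<c (<⇒≤ c<λ)) (Inside-[] la r z<s c<λ)

  strict : ∀ k c → 0 < c → c ≤ part la (suc (suc k)) → cell (suc k) c <ᶜ cell (suc (suc k)) c
  strict k c 0<c c≤λ = column-strict cellwise (suc k) c
    (Inside-[] la (suc k) 0<c (≤-trans c≤λ (antitone k))) (Inside-[] la (suc (suc k)) 0<c c≤λ)

  HasLow-closedˡ : ∀ r c → 0 < c → suc c ≤ part la r → HasLow (cell r (suc c)) → HasLow (cell r c)
  HasLow-closedˡ r c 0<c c<λ = ≤ᶜ-HasLow (weak r c 0<c c<λ) (nonempty r c 0<c (<⇒≤ c<λ))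

  HasLow-closedᵘ : ∀ k c → 0 < c → c ≤ part la (suc (suc k)) → HasLow (cell (suc (suc k)) c) →
    c ≤ part la (suc k) × HasLow (cell (suc k) c)
  HasLow-closedᵘ k c 0<c c≤λ low =
    c≤λ′ , ≤ᶜ-HasLow (<ᶜ⇒≤ᶜ (strict k c 0<c c≤λ)) (nonempty (suc k) c 0<c c≤λ′) low
    where
    c≤λ′ : c ≤ part la (suc k)
    c≤λ′ = ≤-trans c≤λ (antitone k)

  AllLow-closedˡ : ∀ r c → 0 < c → suc c ≤ part la r → AllLow (cell r (suc c)) → AllLow (cell r c)
  AllLow-closedˡ r c 0<c c<λ = ≤ᶜ-AllLow (weak r c 0<c c<λ) (nonempty r (suc c) z<s c<λ)

  AllLow-closedᵘ : ∀ k c → 0 < c → c ≤ part la (suc (suc k)) → AllLow (cell (suc (suc k)) c) →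
    c ≤ part la (suc k) × AllLow (cell (suc k) c)
  AllLow-closedᵘ k c 0<c c≤λ low =
    ≤-trans c≤λ (antitone k) , ≤ᶜ-AllLow (<ᶜ⇒≤ᶜ (strict k c 0<c c≤λ)) (nonempty (suc (suc k)) c 0<c c≤λ) low

  ν μ : List ℕ
  ν = shapeν T
  μ = shapeμ T

  private
    module ν = ShapeOf HasLow? la cell HasLow-closedˡ HasLow-closedᵘ
    module μ = ShapeOf AllLow? la cell AllLow-closedˡ AllLow-closedᵘ

  ν-partition : IsPartition ν
  ν-partition = subst (IsPartition ∘ shapeν) (sym T≡) ν.shape-IsPartition

  μ-partition : IsPartition μ
  μ-partition = subst (IsPartition ∘ shapeμ) (sym T≡) μ.shape-IsPartition

  ν⇒ : ∀ r c → 0 < c → c ≤ part ν r → c ≤ part la r × HasLow (cell r c)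
  ν⇒ r c 0<c = ν.shape⇒ r c 0<c ∘ subst (λ T′ → c ≤ part (shapeν T′) r) T≡

  ν⇐ : ∀ r c → 0 < c → c ≤ part la r → HasLow (cell r c) → c ≤ part ν r
  ν⇐ r c 0<c c≤λ = subst (λ T′ → c ≤ part (shapeν T′) r) (sym T≡) ∘ ν.shape⇐ r c 0<c c≤λ

  μ⇒ : ∀ r c → 0 < c → c ≤ part μ r → c ≤ part la r × AllLow (cell r c)
  μ⇒ r c 0<c = μ.shape⇒ r c 0<c ∘ subst (λ T′ → c ≤ part (shapeμ T′) r) T≡

  μ⇐ : ∀ r c → 0 < c → c ≤ part la r → AllLow (cell r c) → c ≤ part μ r
  μ⇐ r c 0<c c≤λ = subst (λ T′ → c ≤ part (shapeμ T′) r) (sym T≡) ∘ μ.shape⇐ r c 0<c c≤λ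

  ν≤λ : ∀ r → part ν r ≤ part la r
  ν≤λ r = ≤-fromBelow _ _ λ c 0<c c≤ν → proj₁ (ν⇒ r c 0<c c≤ν)

  μ≤ν : ∀ r → part μ r ≤ part ν r
  μ≤ν r = ≤-fromBelow _ _ λ c 0<c c≤μ →
    let c≤λ , low = μ⇒ r c 0<c c≤μ in ν⇐ r c 0<c c≤λ (AllLow⇒HasLow (nonempty r c 0<c c≤λ) low)

  ν⊆λ : ν ⊆P la
  ν⊆λ = IsPartition-length-mono ν la ν-partition (ν≤λ ∘ suc) , ν≤λ

  μ⊆ν : μ ⊆P ν
  μ⊆ν = IsPartition-length-mono μ ν μ-partition (μ≤ν ∘ suc) , μ≤ν

  skew⇒mixed : ∀ r c → InSkew ν μ r c → 0 < c × c ≤ part la r × HasLow (cell r c) × ¬ AllLow (cell r c)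
  skew⇒mixed r c (_ , μ<c , c≤ν) = 0<c , c≤λ , low , λ all → <⇒≱ μ<c (μ⇐ r c 0<c c≤λ all)
    where
    0<c = ≤-<-trans z≤n μ<c
    c≤λ = proj₁ (ν⇒ r c 0<c c≤ν)
    low = proj₂ (ν⇒ r c 0<c c≤ν)

  -- a cell with a positive entry cannot lie weakly left of, or strictly above, a cell with an entry ≤ 0
  ν/μ-disconnected : Disconnected ν μ
  ν/μ-disconnected r c skew = right , below r skew
    where
    0<c = proj₁ (skew⇒mixed r c skew)
    right : ¬ InSkew ν μ r (suc c)
    right skew′ = let _ , _ , _ , ¬low = skew⇒mixed r c skew
                      _ , c<λ , low , _ = skew⇒mixed r (suc c) skew′
                  in ≤ᶜ-high-low (weak r c 0<c c<λ) ¬low low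
    below : ∀ r → InSkew ν μ r c → ¬ InSkew ν μ (suc r) c
    below (suc k) skew skew′ =
      let _ , _ , _ , ¬low = skew⇒mixed (suc k) c skew
          _ , c≤λ , low , _ = skew⇒mixed (suc (suc k)) c skew′
      in ≤ᶜ-high-low (<ᶜ⇒≤ᶜ (strict k c 0<c c≤λ)) ¬low low

  lower-cellwise : CellwiseSSVT ν [] (flagMinus phi) false (λ r c → lower (cell r c))
  lower-cellwise = record { valid-cell = valid ; row-weak = rows ; column-strict = columns }
    where
    valid : ∀ r c → Inside ν [] r c → ValidCell (flagMinus phi) false r (lower (cell r c))
    valid r c inside with ν⇒ r c (Inside-[]⁻ ν r inside) (proj₂ inside)
    ... | c≤λ , low with valid-cell cellwise r c (Inside-[] la r (Inside-[]⁻ ν r inside) c≤λ)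
    ... | _ , inc , flag , _ = lower-nonempty (cell r c) low , AllPairs.filter⁺ low? inc , flag⁻ , λ ()
      where
      flag⁻ : (f : ℤ) → at (flagMinus phi) r ≡ just f → All (λ e → key e ℤ.≤ f) (lower (cell r c))
      flag⁻ f e with at-map⁻ (ℤ._⊓ 0ℤ) phi r e
      ... | f₀ , e₀ , refl =
        All.zipWith (λ (x , y) → ℤₚ.⊓-glb x y) (lower-All _ (flag f₀ e₀) , lower-AllLow (cell r c))
    rows : ∀ r c → Inside ν [] r c → Inside ν [] r (suc c) → lower (cell r c) ≤ᶜ lower (cell r (suc c))
    rows r c inside inside′ = All²-mono (lower-All _) (lower-All _)
      (weak r c (Inside-[]⁻ ν r inside) (proj₁ (ν⇒ r (suc c) z<s (proj₂ inside′))))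
    columns : ∀ r c → Inside ν [] r c → Inside ν [] (suc r) c → lower (cell r c) <ᶜ lower (cell (suc r) c)
    columns zero    c inside _       = ⊥-elim (<⇒≱ (Inside-[]⁻ ν 0 inside) (proj₂ inside))
    columns (suc k) c inside inside′ =
      All²-mono (lower-All _) (lower-All _) (strict k c 0<c (proj₁ (ν⇒ (suc (suc k)) c 0<c (proj₂ inside′))))
      where
      0<c : 0 < c
      0<c = Inside-[]⁻ ν (suc k) inside

  upper-cellwise : CellwiseSSVT la μ phi true (λ r c → upper (cell r c))
  upper-cellwise = record { valid-cell = valid ; row-weak = rows ; column-strict = columns }
    where
    valid : ∀ r c → Inside la μ r c → ValidCell phi true r (upper (cell r c))
    valid r c (μ<c , c≤λ) with valid-cell cellwise r c (Inside-[] la r (≤-<-trans z≤n μ<c) c≤λ)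
    ... | _ , inc , flag , _ =
      upper-nonempty (cell r c) (λ all → <⇒≱ μ<c (μ⇐ r c (≤-<-trans z≤n μ<c) c≤λ all))
      , AllPairs.filter⁺ high? inc , (λ f e → upper-All _ (flag f e)) , λ _ → upper-AllHigh (cell r c)
    rows : ∀ r c → Inside la μ r c → Inside la μ r (suc c) → upper (cell r c) ≤ᶜ upper (cell r (suc c))
    rows r c (μ<c , _) (_ , c<λ) = All²-mono (upper-All _) (upper-All _) (weak r c (≤-<-trans z≤n μ<c) c<λ)
    columns : ∀ r c → Inside la μ r c → Inside la μ (suc r) c → upper (cell r c) <ᶜ upper (cell (suc r) c)
    columns zero    c (μ<c , c≤λ) _          = ⊥-elim (<⇒≱ μ<c c≤λ)
    columns (suc k) c (μ<c , _)   (_ , c≤λ′) =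
      All²-mono (upper-All _) (upper-All _) (strict k c (≤-<-trans z≤n μ<c) c≤λ′)

  splitTab-valid : RHSValid la phi (splitTab la T)
  splitTab-valid = ν-partition , ν⊆λ , μ-partition , μ⊆ν , ν/μ-disconnected
    , CellwiseSSVT⇒SSVT ν [] (flagMinus phi) false _ lower-cellwise
    , CellwiseSSVT⇒SSVT la μ phi true _ upper-cellwise

-- Merging the two tableaux of a right-hand term

mergeTab : List ℕ → RIdx → Tab
mergeTab la (nu , mu , T1 , T2) = tabulateTab la [] (λ r c → cellOf T1 [] r c ++ cellOf T2 mu r c)

AllLow-AllHigh⇒<ᶜ : ∀ {C D} → AllLow C → All IsHigh D → C <ᶜ D
AllLow-AllHigh⇒<ᶜ low high = All.map (λ e≤0 → All.map (ℤₚ.≤-<-trans e≤0) high) low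

All²-++ : ∀ {R : Entry → Entry → Set} {A B C D : Cell} →
  All (λ e → All (R e) C) A → All (λ e → All (R e) D) A → All (λ e → All (R e) C) B → All (λ e → All (R e) D) B →
  All (λ e → All (R e) (C ++ D)) (A ++ B)
All²-++ AC AD BC BD =
  All.++⁺ (All.zipWith (λ (x , y) → All.++⁺ x y) (AC , AD)) (All.zipWith (λ (x , y) → All.++⁺ x y) (BC , BD))

All²-[] : ∀ {R : Entry → Entry → Set} (C : Cell) → All (λ e → All (R e) []) C
All²-[] C = All.tabulate (λ _ → [])

NonEmpty-++ˡ : (A : Cell) {B : Cell} → NonEmpty A → NonEmpty (A ++ B)
NonEmpty-++ˡ (_ ∷ _) _ = tt

NonEmpty-++ʳ : (A : Cell) {B : Cell} → NonEmpty B → NonEmpty (A ++ B)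
NonEmpty-++ʳ []      ne = ne
NonEmpty-++ʳ (_ ∷ _) _  = tt

module MergeTableaux (la : List ℕ) (phi : List ℤ) (phi-length : length phi ≡ length la)
  (j : RIdx) (v : RHSValid la phi j) where

  ν μ : List ℕ
  ν = proj₁ j
  μ = proj₁ (proj₂ j)

  T1 T2 : Tab
  T1 = proj₁ (proj₂ (proj₂ j))
  T2 = proj₂ (proj₂ (proj₂ j))

  ν-partition : IsPartition ν
  ν-partition = proj₁ v
  ν⊆λ : ν ⊆P la
  ν⊆λ = proj₁ (proj₂ v)
  μ-partition : IsPartition μ
  μ-partition = proj₁ (proj₂ (proj₂ v))
  μ⊆ν : μ ⊆P ν
  μ⊆ν = proj₁ (proj₂ (proj₂ (proj₂ v)))
  disconnected : Disconnected ν μ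
  disconnected = proj₁ (proj₂ (proj₂ (proj₂ (proj₂ v))))
  v1 : SSVT ν [] (flagMinus phi) false T1
  v1 = proj₁ (proj₂ (proj₂ (proj₂ (proj₂ (proj₂ v)))))
  v2 : SSVT la μ phi true T2
  v2 = proj₂ (proj₂ (proj₂ (proj₂ (proj₂ (proj₂ v)))))

  cell1 cell2 : ℕ → ℕ → Cell
  cell1 = cellOf T1 []
  cell2 = cellOf T2 μ

  cellwise1 : CellwiseSSVT ν [] (flagMinus phi) false cell1
  cellwise1 = SSVT⇒CellwiseSSVT ν [] (flagMinus phi) false T1 v1
  cellwise2 : CellwiseSSVT la μ phi true cell2
  cellwise2 = SSVT⇒CellwiseSSVT la μ phi true T2 v2

  merged : ℕ → ℕ → Cell
  merged r c = cell1 r c ++ cell2 r c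

  ν≤λ : ∀ r → part ν r ≤ part la r
  ν≤λ = proj₂ ν⊆λ

  μ≤ν : ∀ r → part μ r ≤ part ν r
  μ≤ν = proj₂ μ⊆ν

  cell1-outside : ∀ r c → ¬ Inside ν [] r c → cell1 r c ≡ []
  cell1-outside r c outside =
    trans (cong (λ T → cellOf T [] r c) (SSVT⇒≡tabulateTab ν [] (flagMinus phi) false T1 v1))
          (cellOf-tabulateTab-outside ν [] cell1 r c outside)

  cell2-outside : ∀ r c → ¬ Inside la μ r c → cell2 r c ≡ []
  cell2-outside r c outside =
    trans (cong (λ T → cellOf T μ r c) (SSVT⇒≡tabulateTab la μ phi true T2 v2))
          (cellOf-tabulateTab-outside la μ cell2 r c outside)

  everywhere1 : (P : Cell → Set) → P [] → ∀ r c → (Inside ν [] r c → P (cell1 r c)) → P (cell1 r c)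
  everywhere1 P P[] r c inside with Inside? ν [] r c
  ... | yes i = inside i
  ... | no  o = subst P (sym (cell1-outside r c o)) P[]

  everywhere2 : (P : Cell → Set) → P [] → ∀ r c → (Inside la μ r c → P (cell2 r c)) → P (cell2 r c)
  everywhere2 P P[] r c inside with Inside? la μ r c
  ... | yes i = inside i
  ... | no  o = subst P (sym (cell2-outside r c o)) P[]

  cell1-Increasing : ∀ r c → Increasing (cell1 r c)
  cell1-Increasing r c = everywhere1 Increasing [] r c λ i → proj₁ (proj₂ (valid-cell cellwise1 r c i))

  cell2-Increasing : ∀ r c → Increasing (cell2 r c)
  cell2-Increasing r c = everywhere2 Increasing [] r c λ i → proj₁ (proj₂ (valid-cell cellwise2 r c i))

  cell2-AllHigh : ∀ r c → All IsHigh (cell2 r c)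
  cell2-AllHigh r c = everywhere2 (All IsHigh) [] r c λ i →
    proj₂ (proj₂ (proj₂ (valid-cell cellwise2 r c i))) tt

  cell2-flag : ∀ r c f → at phi r ≡ just f → All (λ e → key e ℤ.≤ f) (cell2 r c)
  cell2-flag r c f e = everywhere2 (All (λ e → key e ℤ.≤ f)) [] r c λ i →
    proj₁ (proj₂ (proj₂ (valid-cell cellwise2 r c i))) f e

  flag-in-ν : ∀ r c → Inside ν [] r c → Σ ℤ λ f → at phi r ≡ just f × at (flagMinus phi) r ≡ just (f ℤ.⊓ 0ℤ)
  flag-in-ν r c i with 0<part⇒row ν r (<-≤-trans (Inside-[]⁻ ν r i) (proj₂ i))
  ... | k , refl , k<ℓ with nth-total phi k (subst (k <_) (sym phi-length) (<-≤-trans k<ℓ (proj₁ ν⊆λ)))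
  ... | f , e = f , e , at-map⁺ (ℤ._⊓ 0ℤ) phi (suc k) e

  cell1-bounded : ∀ r c → Inside ν [] r c → ∀ f → at phi r ≡ just f → All (λ e → key e ℤ.≤ f ℤ.⊓ 0ℤ) (cell1 r c)
  cell1-bounded r c i f e with flag-in-ν r c i
  ... | f′ , e′ , e⁻ with trans (sym e) e′
  ... | refl = proj₁ (proj₂ (proj₂ (valid-cell cellwise1 r c i))) _ e⁻

  cell1-AllLow : ∀ r c → AllLow (cell1 r c)
  cell1-AllLow r c = everywhere1 AllLow [] r c λ i →
    let f , e , _ = flag-in-ν r c i in All.map (λ e≤ → ℤₚ.≤-trans e≤ (ℤₚ.i⊓j≤j f 0ℤ)) (cell1-bounded r c i f e)

  cell1-flag : ∀ r c f → at phi r ≡ just f → All (λ e → key e ℤ.≤ f) (cell1 r c)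
  cell1-flag r c f e = everywhere1 (All (λ e → key e ℤ.≤ f)) [] r c λ i →
    All.map (λ e≤ → ℤₚ.≤-trans e≤ (ℤₚ.i⊓j≤i f 0ℤ)) (cell1-bounded r c i f e)

  merged-Increasing : ∀ r c → Increasing (merged r c)
  merged-Increasing r c = AllPairs.++⁺ (cell1-Increasing r c) (cell2-Increasing r c)
                                       (AllLow-AllHigh⇒<ᶜ (cell1-AllLow r c) (cell2-AllHigh r c))

  merged-nonempty : ∀ r c → Inside la [] r c → NonEmpty (merged r c)
  merged-nonempty r c i with c ≤? part ν r
  ... | yes c≤ν = NonEmpty-++ˡ (cell1 r c)
                    (proj₁ (valid-cell cellwise1 r c (Inside-[] ν r (Inside-[]⁻ la r i) c≤ν)))
  ... | no  c≰ν = NonEmpty-++ʳ (cell1 r c)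
                    (proj₁ (valid-cell cellwise2 r c (≤-<-trans (μ≤ν r) (≰⇒> c≰ν) , proj₂ i)))

  Inside⇒InSkew : ∀ r c → Inside la μ r c → c ≤ part ν r → InSkew ν μ r c
  Inside⇒InSkew zero    c (μ<c , c≤λ) _   = ⊥-elim (<⇒≱ μ<c c≤λ)
  Inside⇒InSkew (suc k) c (μ<c , _)   c≤ν = s≤s z≤n , μ<c , c≤ν

  -- a cell of T2 inside ν lies in ν/μ, so by disconnectedness its right and lower neighbours are not cells of T1
  merged-row-weak : ∀ r c → Inside la [] r c → Inside la [] r (suc c) → merged r c ≤ᶜ merged r (suc c)
  merged-row-weak r c i i′ =
    All²-++ weak11 (<ᶜ⇒≤ᶜ (AllLow-AllHigh⇒<ᶜ (cell1-AllLow r c) (cell2-AllHigh r (suc c)))) weak21 weak22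
    where
    weak11 : cell1 r c ≤ᶜ cell1 r (suc c)
    weak11 with Inside? ν [] r (suc c)
    ... | no  o  = subst (cell1 r c ≤ᶜ_) (sym (cell1-outside r (suc c) o)) (All²-[] (cell1 r c))
    ... | yes i1 = row-weak cellwise1 r c (Inside-[] ν r (Inside-[]⁻ la r i) (<⇒≤ (proj₂ i1))) i1
    weak21 : cell2 r c ≤ᶜ cell1 r (suc c)
    weak21 with Inside? la μ r c | Inside? ν [] r (suc c)
    ... | no  o  | _     = subst (_≤ᶜ cell1 r (suc c)) (sym (cell2-outside r c o)) []
    ... | yes _  | no o  = subst (cell2 r c ≤ᶜ_) (sym (cell1-outside r (suc c) o)) (All²-[] (cell2 r c))
    ... | yes i2 | yes i1 = ⊥-elim (proj₁ (disconnected r c (Inside⇒InSkew r c i2 (<⇒≤ (proj₂ i1))))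
                                      (Inside⇒InSkew r (suc c) (<-trans (proj₁ i2) (n<1+n c) , proj₂ i′) (proj₂ i1)))
    weak22 : cell2 r c ≤ᶜ cell2 r (suc c)
    weak22 with Inside? la μ r c
    ... | no  o  = subst (_≤ᶜ cell2 r (suc c)) (sym (cell2-outside r c o)) []
    ... | yes i2 = row-weak cellwise2 r c i2 (<-trans (proj₁ i2) (n<1+n c) , proj₂ i′)

  merged-column-strict : ∀ r c → Inside la [] r c → Inside la [] (suc r) c → merged r c <ᶜ merged (suc r) c
  merged-column-strict zero    c i _  = ⊥-elim (<⇒≱ (Inside-[]⁻ la 0 i) (proj₂ i))
  merged-column-strict (suc k) c i i′ =
    All²-++ strict11 (AllLow-AllHigh⇒<ᶜ (cell1-AllLow r c) (cell2-AllHigh (suc r) c)) strict21 strict22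
    where
    r : ℕ
    r = suc k
    ν-antitone : part ν (suc r) ≤ part ν r
    ν-antitone = IsPartition⇒Antitone ν ν-partition k
    μ-antitone : part μ (suc r) ≤ part μ r
    μ-antitone = IsPartition⇒Antitone μ μ-partition k
    strict11 : cell1 r c <ᶜ cell1 (suc r) c
    strict11 with Inside? ν [] (suc r) c
    ... | no  o  = subst (cell1 r c <ᶜ_) (sym (cell1-outside (suc r) c o)) (All²-[] (cell1 r c))
    ... | yes i1 = column-strict cellwise1 r c
                     (Inside-[] ν r (Inside-[]⁻ la r i) (≤-trans (proj₂ i1) ν-antitone)) i1
    strict21 : cell2 r c <ᶜ cell1 (suc r) c
    strict21 with Inside? la μ r c | Inside? ν [] (suc r) c
    ... | no  o  | _      = subst (_<ᶜ cell1 (suc r) c) (sym (cell2-outside r c o)) []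
    ... | yes _  | no o   = subst (cell2 r c <ᶜ_) (sym (cell1-outside (suc r) c o)) (All²-[] (cell2 r c))
    ... | yes i2 | yes i1 = ⊥-elim (proj₂ (disconnected r c (Inside⇒InSkew r c i2 (≤-trans (proj₂ i1) ν-antitone)))
                                      (Inside⇒InSkew (suc r) c (≤-<-trans μ-antitone (proj₁ i2) , proj₂ i′) (proj₂ i1)))
    strict22 : cell2 r c <ᶜ cell2 (suc r) c
    strict22 with Inside? la μ r c
    ... | no  o  = subst (_<ᶜ cell2 (suc r) c) (sym (cell2-outside r c o)) []
    ... | yes i2 = column-strict cellwise2 r c i2 (≤-<-trans μ-antitone (proj₁ i2) , proj₂ i′)

  merged-cellwise : CellwiseSSVT la [] phi false merged
  merged-cellwise = record
    { valid-cell    = λ r c i → merged-nonempty r c i , merged-Increasing r c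
                                , (λ f e → All.++⁺ (cell1-flag r c f e) (cell2-flag r c f e)) , λ ()
    ; row-weak      = merged-row-weak
    ; column-strict = merged-column-strict
    }

  mergeTab-valid : LHSValid la phi (mergeTab la j)
  mergeTab-valid = CellwiseSSVT⇒SSVT la [] phi false merged merged-cellwise

mergeTab-splitTab : ∀ la phi → IsPartition la → ∀ T → SSVT la [] phi false T → mergeTab la (splitTab la T) ≡ T
mergeTab-splitTab la phi la-partition T v = trans (tabulateTab-cong la [] _ cell lower++upper-cells) (sym T≡)
  where
  open SplitTableau la phi la-partition T v
  lower++upper-cells : ∀ r c → Inside la [] r c →
    cellOf (lowerTab T) [] r c ++ cellOf (upperTab la T) μ r c ≡ cell r c
  lower++upper-cells r c i =
    trans (cong₂ _++_ lower≡ upper≡) (lower++upper (cell r c) (proj₁ (proj₂ (valid-cell cellwise r c i))))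
    where
    0<c : 0 < c
    0<c = Inside-[]⁻ la r i
    lower≡ : cellOf (lowerTab T) [] r c ≡ lower (cell r c)
    lower≡ with Inside? ν [] r c
    ... | yes i1 = cellOf-tabulateTab ν [] _ r c i1
    ... | no  o  = trans (cellOf-tabulateTab-outside ν [] _ r c o)
                         (sym (lower-empty (cell r c) λ low → o (Inside-[] ν r 0<c (ν⇐ r c 0<c (proj₂ i) low))))
    upper≡ : cellOf (upperTab la T) μ r c ≡ upper (cell r c)
    upper≡ with Inside? la μ r c
    ... | yes i2 = cellOf-tabulateTab la μ _ r c i2
    ... | no  o  = trans (cellOf-tabulateTab-outside la μ _ r c o)
                         (sym (upper-empty (cell r c) (proj₂ (μ⇒ r c 0<c (≮⇒≥ λ μ<c → o (μ<c , proj₂ i))))))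

module _ (la : List ℕ) (phi : List ℤ) (la-partition : IsPartition la)
  (phi-length : length phi ≡ length la) (j : RIdx) (v : RHSValid la phi j) where

  open MergeTableaux la phi phi-length j v
  private
    M : Tab
    M = mergeTab la j
    module S = SplitTableau la phi la-partition M mergeTab-valid

    cellM : ∀ r c → 0 < c → c ≤ part la r → cellOf M [] r c ≡ merged r c
    cellM r c 0<c c≤λ = cellOf-tabulateTab la [] merged r c (Inside-[] la r 0<c c≤λ)

    cell1-nonempty : ∀ r c → 0 < c → c ≤ part ν r → NonEmpty (cell1 r c)
    cell1-nonempty r c 0<c c≤ν = proj₁ (valid-cell cellwise1 r c (Inside-[] ν r 0<c c≤ν))

    shapeν≡ : S.ν ≡ ν
    shapeν≡ = IsPartition-unique S.ν ν S.ν-partition ν-partition λ k →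
      ≡-fromBelow _ _ (ν′≤ν (suc k)) (ν≤ν′ (suc k))
      where
      ν′≤ν : ∀ r c → 0 < c → c ≤ part S.ν r → c ≤ part ν r
      ν′≤ν r c 0<c c≤ν′ with c ≤? part ν r
      ... | yes c≤ν = c≤ν
      ... | no  c≰ν = ⊥-elim (AllHigh⇒¬HasLow (cell2-AllHigh r c)
            (subst (λ C → HasLow (C ++ cell2 r c)) (cell1-outside r c (c≰ν ∘ proj₂))
                   (subst HasLow (cellM r c 0<c c≤λ) low)))
        where
        c≤λ : c ≤ part la r
        c≤λ = proj₁ (S.ν⇒ r c 0<c c≤ν′)
        low : HasLow (cellOf M [] r c)
        low = proj₂ (S.ν⇒ r c 0<c c≤ν′)
      ν≤ν′ : ∀ r c → 0 < c → c ≤ part ν r → c ≤ part S.ν r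
      ν≤ν′ r c 0<c c≤ν = S.ν⇐ r c 0<c c≤λ (subst HasLow (sym (cellM r c 0<c c≤λ))
        (Any.++⁺ˡ (AllLow⇒HasLow (cell1-nonempty r c 0<c c≤ν) (cell1-AllLow r c))))
        where
        c≤λ : c ≤ part la r
        c≤λ = ≤-trans c≤ν (ν≤λ r)

    shapeμ≡ : S.μ ≡ μ
    shapeμ≡ = IsPartition-unique S.μ μ S.μ-partition μ-partition λ k →
      ≡-fromBelow _ _ (μ′≤μ (suc k)) (μ≤μ′ (suc k))
      where
      μ′≤μ : ∀ r c → 0 < c → c ≤ part S.μ r → c ≤ part μ r
      μ′≤μ r c 0<c c≤μ′ with c ≤? part μ r
      ... | yes c≤μ = c≤μ
      ... | no  c≰μ = ⊥-elim (AllHigh⇒¬AllLow (proj₁ (valid-cell cellwise2 r c (≰⇒> c≰μ , c≤λ))) (cell2-AllHigh r c)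
                               (proj₂ (All.++⁻ (cell1 r c) (subst AllLow (cellM r c 0<c c≤λ) low))))
        where
        c≤λ : c ≤ part la r
        c≤λ = proj₁ (S.μ⇒ r c 0<c c≤μ′)
        low : AllLow (cellOf M [] r c)
        low = proj₂ (S.μ⇒ r c 0<c c≤μ′)
      μ≤μ′ : ∀ r c → 0 < c → c ≤ part μ r → c ≤ part S.μ r
      μ≤μ′ r c 0<c c≤μ = S.μ⇐ r c 0<c c≤λ (subst AllLow (sym (cellM r c 0<c c≤λ))
        (All.++⁺ (cell1-AllLow r c) (subst AllLow (sym (cell2-outside r c λ i → <⇒≱ (proj₁ i) c≤μ)) [])))
        where
        c≤λ : c ≤ part la r
        c≤λ = ≤-trans c≤μ (≤-trans (μ≤ν r) (ν≤λ r))

  splitTab-mergeTab : splitTab la M ≡ j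
  splitTab-mergeTab = cong₂ _,_ shapeν≡ (cong₂ _,_ shapeμ≡ (cong₂ _,_ lowerTab≡ upperTab≡))
    where
    lowerTab≡ : lowerTab M ≡ T1
    lowerTab≡ = begin
      tabulateTab S.ν [] (λ r c → lower (cellOf M [] r c))
        ≡⟨ cong (λ shape → tabulateTab shape [] (λ r c → lower (cellOf M [] r c))) shapeν≡ ⟩
      tabulateTab ν [] (λ r c → lower (cellOf M [] r c))
        ≡⟨ tabulateTab-cong ν [] _ cell1 lower≡ ⟩
      tabulateTab ν [] cell1
        ≡⟨ SSVT⇒≡tabulateTab ν [] (flagMinus phi) false T1 v1 ⟨
      T1 ∎
      where
      open ≡-Reasoning
      lower≡ : ∀ r c → Inside ν [] r c → lower (cellOf M [] r c) ≡ cell1 r c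
      lower≡ r c i = trans (cong lower (cellM r c (Inside-[]⁻ ν r i) (≤-trans (proj₂ i) (ν≤λ r))))
                           (lower-++ (cell1 r c) (cell2 r c) (cell1-AllLow r c) (cell2-AllHigh r c))
    upperTab≡ : upperTab la M ≡ T2
    upperTab≡ = begin
      tabulateTab la S.μ (λ r c → upper (cellOf M [] r c))
        ≡⟨ cong (λ shape → tabulateTab la shape (λ r c → upper (cellOf M [] r c))) shapeμ≡ ⟩
      tabulateTab la μ (λ r c → upper (cellOf M [] r c))
        ≡⟨ tabulateTab-cong la μ _ cell2 upper≡ ⟩
      tabulateTab la μ cell2
        ≡⟨ SSVT⇒≡tabulateTab la μ phi true T2 v2 ⟨
      T2 ∎
      where
      open ≡-Reasoning
      upper≡ : ∀ r c → Inside la μ r c → upper (cellOf M [] r c) ≡ cell2 r c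
      upper≡ r c i = trans (cong upper (cellM r c (≤-<-trans z≤n (proj₁ i)) (proj₂ i)))
                           (upper-++ (cell1 r c) (cell2 r c) (cell1-AllLow r c) (cell2-AllHigh r c))

select : {P : Set} → Dec P → STerm → STerm
select (yes _) t = t
select (no  _) _ = oneT

select-yes : {P : Set} (d : Dec P) (t : STerm) → P → select d t ≡ t
select-yes (yes _) t _ = refl
select-yes (no ¬p) t p = ⊥-elim (¬p p)

select-no : {P : Set} (d : Dec P) (t : STerm) → ¬ P → select d t ≡ oneT
select-no (yes p) t ¬p = ⊥-elim (¬p p)
select-no (no  _) t _  = refl

∏range : (ℕ → STerm) → ℕ → ℕ → STerm
∏range F s zero    = oneT
∏range F s (suc n) = F s ⊗ ∏range F (suc s) n

∏range-cong : ∀ F G s n → (∀ j → j < n → F (s + j) ≈T G (s + j)) → ∏range F s n ≈T ∏range G s n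
∏range-cong F G s zero    F≈G = ≈T-refl
∏range-cong F G s (suc n) F≈G = ⊗-cong
  (subst (λ k → F k ≈T G k) (+-identityʳ s) (F≈G 0 z<s))
  (∏range-cong F G (suc s) n λ j j<n → subst (λ k → F k ≈T G k) (+-suc s j) (F≈G (suc j) (s<s j<n)))

∏range-trivial : ∀ F s n → (∀ j → j < n → F (s + j) ≈T oneT) → ∏range F s n ≈T oneT
∏range-trivial F s n F≈1 = ≈T-trans (∏range-cong F (λ _ → oneT) s n F≈1) (ones s n)
  where
  ones : ∀ s n → ∏range (λ _ → oneT) s n ≈T oneT
  ones s zero    = ≈T-refl
  ones s (suc n) = ≈T-trans (⊗-identityˡ _) (ones (suc s) n)

∏range-+ : ∀ F s m n → ∏range F s (m + n) ≈T ∏range F s m ⊗ ∏range F (s + m) n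
∏range-+ F s zero    n =
  subst (λ k → ∏range F s n ≈T oneT ⊗ ∏range F k n) (sym (+-identityʳ s)) (≈T-sym (⊗-identityˡ _))
∏range-+ F s (suc m) n = begin
  F s ⊗ ∏range F (suc s) (m + n)                       ≈⟨ ⊗-cong (≈T-refl {F s}) (∏range-+ F (suc s) m n) ⟩
  F s ⊗ (∏range F (suc s) m ⊗ ∏range F (suc s + m) n)  ≈⟨ ⊗-assoc (F s) _ _ ⟨
  (F s ⊗ ∏range F (suc s) m) ⊗ ∏range F (suc s + m) n  ≡⟨ cong (λ k → (F s ⊗ ∏range F (suc s) m) ⊗ ∏range F k n) (sym (+-suc s m)) ⟩
  (F s ⊗ ∏range F (suc s) m) ⊗ ∏range F (s + suc m) n  ∎
  where open ≈-Reasoning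

∏range-⊗ : ∀ F G s n → ∏range (λ c → F c ⊗ G c) s n ≈T ∏range F s n ⊗ ∏range G s n
∏range-⊗ F G s zero    = ≈T-sym (⊗-identityˡ oneT)
∏range-⊗ F G s (suc n) =
  ≈T-trans (⊗-cong (≈T-refl {F s ⊗ G s}) (∏range-⊗ F G (suc s) n)) (interchange (F s) (G s) _ _)

∏range-select : ∀ (P : ℕ → Set) (P? : ∀ c → Dec (P c)) (G : ℕ → STerm) m n K →
  (∀ c → P c → m < c × c ≤ m + n) → (∀ j → j < n → P (suc m + j)) → m + n ≤ K →
  ∏range G (suc m) n ≈T ∏range (λ c → select (P? c) (G c)) 1 K
∏range-select P P? G m n K P⇒window window⇒P m+n≤K = begin
  ∏range G (suc m) n
    ≈⟨ ∏range-cong G H (suc m) n (λ j j<n → ≡⇒≈T (sym (select-yes (P? _) _ (window⇒P j j<n)))) ⟩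
  ∏range H (suc m) n
    ≈⟨ ⊗-identityˡ _ ⟨
  oneT ⊗ ∏range H (suc m) n
    ≈⟨ ⊗-cong (≈T-sym (∏range-trivial H 1 m before)) (≈T-sym (⊗-identityʳ _)) ⟩
  ∏range H 1 m ⊗ (∏range H (suc m) n ⊗ oneT)
    ≈⟨ ⊗-cong (≈T-refl {∏range H 1 m}) (⊗-cong (≈T-refl {∏range H (suc m) n}) (≈T-sym (∏range-trivial H _ _ after))) ⟩
  ∏range H 1 m ⊗ (∏range H (suc m) n ⊗ ∏range H (suc m + n) (K ∸ (m + n)))
    ≈⟨ ⊗-cong (≈T-refl {∏range H 1 m}) (∏range-+ H (suc m) n _) ⟨
  ∏range H 1 m ⊗ ∏range H (suc m) (n + (K ∸ (m + n)))
    ≈⟨ ∏range-+ H 1 m _ ⟨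
  ∏range H 1 (m + (n + (K ∸ (m + n))))
    ≡⟨ cong (∏range H 1) (trans (sym (+-assoc m n _)) (m+[n∸m]≡n m+n≤K)) ⟩
  ∏range H 1 K ∎
  where
  open ≈-Reasoning
  H : ℕ → STerm
  H c = select (P? c) (G c)
  before : ∀ j → j < m → H (1 + j) ≈T oneT
  before j j<m = ≡⇒≈T (select-no (P? (1 + j)) _ λ p → <⇒≱ (proj₁ (P⇒window _ p)) j<m)
  after : ∀ j → j < K ∸ (m + n) → H (suc m + n + j) ≈T oneT
  after j _ = ≡⇒≈T (select-no (P? _) _ λ p → <⇒≱ (s≤s (m≤m+n (m + n) j)) (proj₂ (P⇒window _ p)))

∏grid : ℕ → ℕ → (ℕ → ℕ → STerm) → STerm
∏grid R K F = ∏range (λ r → ∏range (F r) 1 K) 1 R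

∏grid-⊗ : ∀ R K F G → ∏grid R K (λ r c → F r c ⊗ G r c) ≈T ∏grid R K F ⊗ ∏grid R K G
∏grid-⊗ R K F G =
  ≈T-trans (∏range-cong _ _ 1 R λ j _ → ∏range-⊗ (F (1 + j)) (G (1 + j)) 1 K) (∏range-⊗ _ _ 1 R)

∏grid-cong : ∀ R K F G → (∀ r c → F r c ≈T G r c) → ∏grid R K F ≈T ∏grid R K G
∏grid-cong R K F G F≈G = ∏range-cong _ _ 1 R λ j _ → ∏range-cong _ _ 1 K λ i _ → F≈G _ _

part≤size : ∀ la r → part la r ≤ size la
part≤size la       zero          = z≤n
part≤size []       (suc k)       = z≤n
part≤size (x ∷ la) (suc zero)    = m≤m+n x _
part≤size (x ∷ la) (suc (suc k)) = ≤-trans (part≤size la (suc k)) (m≤n+m _ x)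

part-beyond : ∀ la k → length la ≤ k → part la (suc k) ≡ 0
part-beyond la k ℓ≤k = cong (fromMaybe 0) (nth-beyond la k ℓ≤k)

∏shape≈∏grid : ∀ la mu (G : ℕ → ℕ → STerm) R K →
  length la ≤ R → (∀ r → part la r ≤ K) → (∀ r → part mu r ≤ part la r) →
  ∏range (λ r → ∏range (G r) (suc (part mu r)) (part la r ∸ part mu r)) 1 (length la)
    ≈T ∏grid R K (λ r c → select (Inside? la mu r c) (G r c))
∏shape≈∏grid la mu G R K ℓ≤R λ≤K μ≤λ = begin
  ∏range (λ r → ∏range (G r) (suc (part mu r)) (part la r ∸ part mu r)) 1 (length la)
    ≈⟨ ∏range-cong _ Row 1 (length la) (λ j _ → row (suc j)) ⟩
  ∏range Row 1 (length la)
    ≈⟨ ⊗-identityʳ _ ⟨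
  ∏range Row 1 (length la) ⊗ oneT
    ≈⟨ ⊗-cong (≈T-refl {∏range Row 1 (length la)}) (≈T-sym (∏range-trivial Row (1 + length la) (R ∸ length la) empty-row)) ⟩
  ∏range Row 1 (length la) ⊗ ∏range Row (1 + length la) (R ∸ length la)
    ≈⟨ ∏range-+ Row 1 (length la) _ ⟨
  ∏range Row 1 (length la + (R ∸ length la))
    ≡⟨ cong (∏range Row 1) (m+[n∸m]≡n ℓ≤R) ⟩
  ∏range Row 1 R ∎
  where
  open ≈-Reasoning
  Row : ℕ → STerm
  Row r = ∏range (λ c → select (Inside? la mu r c) (G r c)) 1 K
  row : ∀ r → ∏range (G r) (suc (part mu r)) (part la r ∸ part mu r) ≈T Row r
  row r = ∏range-select (Inside la mu r) (Inside? la mu r) (G r) (part mu r) (part la r ∸ part mu r) K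
    (λ c i → proj₁ i , subst (c ≤_) (sym (m+[n∸m]≡n (μ≤λ r))) (proj₂ i))
    (λ j j<n → s≤s (m≤m+n _ j) , <∸⇒suc+≤ _ j _ j<n)
    (subst (_≤ K) (sym (m+[n∸m]≡n (μ≤λ r))) (λ≤K r))
  empty-row : ∀ j → j < R ∸ length la → Row (1 + length la + j) ≈T oneT
  empty-row j _ = ∏range-trivial _ 1 K λ i _ →
    ≡⇒≈T (select-no (Inside? la mu (1 + length la + j) (1 + i)) _ λ i′ →
      <⇒≱ (≤-<-trans z≤n (proj₁ i′)) (subst (1 + i ≤_) (part-beyond la (length la + j) (m≤m+n _ j)) (proj₂ i′)))

termAt : ℕ → ℕ → Cell → STerm
termAt r c = cellTerm (ℤ.+ c ℤ.- ℤ.+ r)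

rowTerm-tabulate : ∀ r s n (f : ℕ → Cell) → rowTerm r s (map f (range s n)) ≡ ∏range (λ c → termAt r c (f c)) s n
rowTerm-tabulate r s zero    f = refl
rowTerm-tabulate r s (suc n) f = cong (cellTerm (ℤ.+ s ℤ.- ℤ.+ r) (f s) ⊗_) (rowTerm-tabulate r (suc s) n f)

tabTerm′-tabulate : ∀ la mu f r₀ n → tabTerm' mu r₀ (map (tabulateRow la mu f) (range r₀ n)) ≡
  ∏range (λ r → ∏range (λ c → termAt r c (f r c)) (suc (part mu r)) (part la r ∸ part mu r)) r₀ n
tabTerm′-tabulate la mu f r₀ zero    = refl
tabTerm′-tabulate la mu f r₀ (suc n) =
  cong₂ _⊗_ (rowTerm-tabulate r₀ (suc (part mu r₀)) (part la r₀ ∸ part mu r₀) (f r₀))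
            (tabTerm′-tabulate la mu f (suc r₀) n)

tabTerm≈∏grid : ∀ la mu f R K → length la ≤ R → (∀ r → part la r ≤ K) → (∀ r → part mu r ≤ part la r) →
  tabTerm mu (tabulateTab la mu f) ≈T ∏grid R K (λ r c → select (Inside? la mu r c) (termAt r c (f r c)))
tabTerm≈∏grid la mu f R K ℓ≤R λ≤K μ≤λ =
  ≈T-trans (≡⇒≈T (tabTerm′-tabulate la mu f 1 (length la))) (∏shape≈∏grid la mu _ R K ℓ≤R λ≤K μ≤λ)

β^ : ℕ → STerm
β^ n = mono n [] [] , ℤ.1ℤ

Σrange : (ℕ → ℕ) → ℕ → ℕ → ℕ
Σrange h s zero    = 0
Σrange h s (suc n) = h s + Σrange h (suc s) n

∏range-β^ : ∀ h s n → ∏range (λ r → β^ (h r)) s n ≈T β^ (Σrange h s n)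
∏range-β^ h s zero    = ≈T-refl
∏range-β^ h s (suc n) = ⊗-cong (≈T-refl {β^ (h s)}) (∏range-β^ h (suc s) n)

∏range-β : ∀ s n → ∏range (λ _ → β^ 1) s n ≈T β^ n
∏range-β s zero    = ≈T-refl
∏range-β s (suc n) = ⊗-cong (≈T-refl {β^ 1}) (∏range-β (suc s) n)

Σrange-cong : ∀ h h′ s n → (∀ j → j < n → h (s + j) ≡ h′ (s + j)) → Σrange h s n ≡ Σrange h′ s n
Σrange-cong h h′ s zero    h≡h′ = refl
Σrange-cong h h′ s (suc n) h≡h′ = cong₂ _+_
  (subst (λ k → h k ≡ h′ k) (+-identityʳ s) (h≡h′ 0 z<s))
  (Σrange-cong h h′ (suc s) n λ j j<n → subst (λ k → h k ≡ h′ k) (+-suc s j) (h≡h′ (suc j) (s<s j<n)))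

Σrange-shift : ∀ h s n → Σrange h (suc s) n ≡ Σrange (h ∘ suc) s n
Σrange-shift h s zero    = refl
Σrange-shift h s (suc n) = cong (h (suc s) +_) (Σrange-shift h (suc s) n)

Σrange-zero : ∀ s n → Σrange (λ _ → 0) s n ≡ 0
Σrange-zero s zero    = refl
Σrange-zero s (suc n) = Σrange-zero (suc s) n

Σrange-part : ∀ la R → length la ≤ R → Σrange (part la) 1 R ≡ size la
Σrange-part []       R       _         = trans (Σrange-cong (part []) (λ _ → 0) 1 R (λ j _ → refl)) (Σrange-zero 1 R)
Σrange-part (x ∷ la) (suc R) (s≤s ℓ≤R) = cong (x +_) (begin
  Σrange (part (x ∷ la)) 2 R         ≡⟨ Σrange-shift (part (x ∷ la)) 1 R ⟩
  Σrange (part (x ∷ la) ∘ suc) 1 R   ≡⟨ Σrange-cong _ (part la) 1 R (λ j _ → refl) ⟩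
  Σrange (part la) 1 R               ≡⟨ Σrange-part la R ℓ≤R ⟩
  size la                            ∎)
  where open ≡-Reasoning

Σrange-mono : ∀ h h′ s n → (∀ j → j < n → h′ (s + j) ≤ h (s + j)) → Σrange h′ s n ≤ Σrange h s n
Σrange-mono h h′ s zero    h′≤h = z≤n
Σrange-mono h h′ s (suc n) h′≤h = +-mono-≤
  (subst (λ k → h′ k ≤ h k) (+-identityʳ s) (h′≤h 0 z<s))
  (Σrange-mono h h′ (suc s) n λ j j<n → subst (λ k → h′ k ≤ h k) (+-suc s j) (h′≤h (suc j) (s<s j<n)))

∸-+-∸ : ∀ {a b A B} → b ≤ a → B ≤ A → (a ∸ b) + (A ∸ B) ≡ (a + A) ∸ (b + B)
∸-+-∸ {a} z≤n     B≤A = sym (+-∸-assoc a B≤A)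
∸-+-∸     (s≤s b≤a) B≤A = ∸-+-∸ b≤a B≤A

Σrange-∸ : ∀ h h′ s n → (∀ j → j < n → h′ (s + j) ≤ h (s + j)) →
  Σrange (λ r → h r ∸ h′ r) s n ≡ Σrange h s n ∸ Σrange h′ s n
Σrange-∸ h h′ s zero    h′≤h = refl
Σrange-∸ h h′ s (suc n) h′≤h = trans (cong ((h s ∸ h′ s) +_) (Σrange-∸ h h′ (suc s) n h′≤h′))
  (∸-+-∸ (subst (λ k → h′ k ≤ h k) (+-identityʳ s) (h′≤h 0 z<s)) (Σrange-mono h h′ (suc s) n h′≤h′))
  where
  h′≤h′ : ∀ j → j < n → h′ (suc s + j) ≤ h (suc s + j)
  h′≤h′ j j<n = subst (λ k → h′ k ≤ h k) (+-suc s j) (h′≤h (suc j) (s<s j<n))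

unβ : STerm → STerm
unβ (mono a x y , s) = mono (a ∸ 1) x y , s

unβ-cong : ∀ {t u} → t ≈T u → unβ t ≈T unβ u
unβ-cong ((a , b , c) , d) = (cong (_∸ 1) a , b , c) , d

∏entryTerm-bdeg>0 : ∀ d A → NonEmpty A → 1 ≤ bdeg (proj₁ (∏ (map (entryTerm d) A)))
∏entryTerm-bdeg>0 d ((i , true  , n) ∷ A) _ = s≤s z≤n
∏entryTerm-bdeg>0 d ((i , false , n) ∷ A) _ = s≤s z≤n

-- joining two nonempty cells costs one factor β, since each cell carries one β^{-1}
cellTerm-++ : ∀ d A B → NonEmpty A → NonEmpty B → cellTerm d (A ++ B) ≈T β^ 1 ⊗ (cellTerm d A ⊗ cellTerm d B)
cellTerm-++ d A B neA neB = ≈T-trans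
  (unβ-cong (≈T-trans (≡⇒≈T (cong ∏ (List.map-++ (entryTerm d) A B)))
                      (∏-++ (map (entryTerm d) A) (map (entryTerm d) B))))
  ((pred-+ (∏entryTerm-bdeg>0 d A neA) (∏entryTerm-bdeg>0 d B neB) , ↭-refl , ↭-refl) , sym (ℤₚ.*-identityˡ _))
  where
  pred-+ : ∀ {a b} → 1 ≤ a → 1 ≤ b → (a + b) ∸ 1 ≡ 1 + ((a ∸ 1) + (b ∸ 1))
  pred-+ {suc a} {suc b} _ _ = +-suc a b

-- Splitting a tableau preserves its term

module SplitTerm (la : List ℕ) (phi : List ℤ) (la-partition : IsPartition la)
  (T : Tab) (v : SSVT la [] phi false T) where
  open SplitTableau la phi la-partition T v

  R K : ℕ
  R = length la
  K = size la

  F F₁ F₂ Fβ : ℕ → ℕ → STerm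
  F  r c = select (Inside? la [] r c) (termAt r c (cell r c))
  F₁ r c = select (Inside? ν [] r c)  (termAt r c (lower (cell r c)))
  F₂ r c = select (Inside? la μ r c)  (termAt r c (upper (cell r c)))
  Fβ r c = select (Inside? ν μ r c)   (β^ 1)

  λ≤K : ∀ r → part la r ≤ K
  λ≤K = part≤size la

  []≤ : ∀ (l : List ℕ) r → part [] r ≤ part l r
  []≤ l r = subst (_≤ part l r) (sym (part-[] r)) z≤n

  T≈ : tabTerm [] T ≈T ∏grid R K F
  T≈ = ≈T-trans (≡⇒≈T (cong (tabTerm []) T≡)) (tabTerm≈∏grid la [] cell R K ≤-refl λ≤K ([]≤ la))

  lowerTab≈ : tabTerm [] (lowerTab T) ≈T ∏grid R K F₁
  lowerTab≈ =
    tabTerm≈∏grid ν [] (λ r c → lower (cell r c)) R K (proj₁ ν⊆λ) (λ r → ≤-trans (ν≤λ r) (λ≤K r)) ([]≤ ν)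

  upperTab≈ : tabTerm μ (upperTab la T) ≈T ∏grid R K F₂
  upperTab≈ =
    tabTerm≈∏grid la μ (λ r c → upper (cell r c)) R K ≤-refl λ≤K (λ r → ≤-trans (μ≤ν r) (ν≤λ r))

  β^skew≈ : β^ (size ν ∸ size μ) ≈T ∏grid R K Fβ
  β^skew≈ = begin
    β^ (size ν ∸ size μ)
      ≡⟨ cong β^ skew-size ⟨
    β^ (Σrange (λ r → part ν r ∸ part μ r) 1 (length ν))
      ≈⟨ ∏range-β^ _ 1 (length ν) ⟨
    ∏range (λ r → β^ (part ν r ∸ part μ r)) 1 (length ν)
      ≈⟨ ∏range-cong _ _ 1 (length ν) (λ j _ → ∏range-β _ _) ⟨
    ∏range (λ r → ∏range (λ _ → β^ 1) (suc (part μ r)) (part ν r ∸ part μ r)) 1 (length ν)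
      ≈⟨ ∏shape≈∏grid ν μ (λ _ _ → β^ 1) R K (proj₁ ν⊆λ) (λ r → ≤-trans (ν≤λ r) (λ≤K r)) μ≤ν ⟩
    ∏grid R K Fβ ∎
    where
    open ≈-Reasoning
    skew-size : Σrange (λ r → part ν r ∸ part μ r) 1 (length ν) ≡ size ν ∸ size μ
    skew-size = trans (Σrange-∸ (part ν) (part μ) 1 (length ν) (λ j _ → μ≤ν (suc j)))
                      (cong₂ _∸_ (Σrange-part ν (length ν) ≤-refl) (Σrange-part μ (length ν) (proj₁ μ⊆ν)))

  private
    rewrite-factors : ∀ r c {t b t₁ t₂} → Fβ r c ≡ b → F₁ r c ≡ t₁ → F₂ r c ≡ t₂ →
      t ≈T b ⊗ (t₁ ⊗ t₂) → t ≈T Fβ r c ⊗ (F₁ r c ⊗ F₂ r c)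
    rewrite-factors r c refl refl refl t≈ = t≈

    Fβ-yes : ∀ r c → Inside ν μ r c → Fβ r c ≡ β^ 1
    Fβ-yes r c = select-yes (Inside? ν μ r c) _
    Fβ-no : ∀ r c → ¬ Inside ν μ r c → Fβ r c ≡ oneT
    Fβ-no r c = select-no (Inside? ν μ r c) _
    F₁-yes : ∀ r c → Inside ν [] r c → F₁ r c ≡ termAt r c (lower (cell r c))
    F₁-yes r c = select-yes (Inside? ν [] r c) _
    F₁-no : ∀ r c → ¬ Inside ν [] r c → F₁ r c ≡ oneT
    F₁-no r c = select-no (Inside? ν [] r c) _
    F₂-yes : ∀ r c → Inside la μ r c → F₂ r c ≡ termAt r c (upper (cell r c))
    F₂-yes r c = select-yes (Inside? la μ r c) _
    F₂-no : ∀ r c → ¬ Inside la μ r c → F₂ r c ≡ oneT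
    F₂-no r c = select-no (Inside? la μ r c) _

  private
    outside-cell : ∀ r c → ¬ Inside la [] r c → oneT ≈T Fβ r c ⊗ (F₁ r c ⊗ F₂ r c)
    outside-cell r c out = rewrite-factors r c
      (Fβ-no r c λ i → out (Inside-[] la r (≤-<-trans z≤n (proj₁ i)) (≤-trans (proj₂ i) (ν≤λ r))))
      (F₁-no r c λ i → out (proj₁ i , ≤-trans (proj₂ i) (ν≤λ r)))
      (F₂-no r c λ i → out (Inside-[] la r (≤-<-trans z≤n (proj₁ i)) (proj₂ i)))
      (≈T-sym (≈T-trans (⊗-identityˡ _) (⊗-identityˡ _)))

    mixed-cell : ∀ r c → Inside la [] r c → HasLow (cell r c) → ¬ AllLow (cell r c) →
      termAt r c (cell r c) ≈T Fβ r c ⊗ (F₁ r c ⊗ F₂ r c)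
    mixed-cell r c i low ¬all = rewrite-factors r c
      (Fβ-yes r c (proj₁ in-λ/μ , proj₂ in-ν)) (F₁-yes r c in-ν) (F₂-yes r c in-λ/μ)
      (subst (λ C → termAt r c C ≈T β^ 1 ⊗ (termAt r c (lower (cell r c)) ⊗ termAt r c (upper (cell r c))))
             (lower++upper (cell r c) (proj₁ (proj₂ (valid-cell cellwise r c i))))
             (cellTerm-++ _ (lower (cell r c)) (upper (cell r c)) (lower-nonempty _ low) (upper-nonempty _ ¬all)))
      where
      in-ν : Inside ν [] r c
      in-ν = Inside-[] ν r (Inside-[]⁻ la r i) (ν⇐ r c (Inside-[]⁻ la r i) (proj₂ i) low)
      in-λ/μ : Inside la μ r c
      in-λ/μ = ≰⇒> (λ c≤μ → ¬all (proj₂ (μ⇒ r c (Inside-[]⁻ la r i) c≤μ))) , proj₂ i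

    low-cell : ∀ r c → Inside la [] r c → AllLow (cell r c) →
      termAt r c (cell r c) ≈T Fβ r c ⊗ (F₁ r c ⊗ F₂ r c)
    low-cell r c i all = rewrite-factors r c
      (Fβ-no r c λ i′ → <⇒≱ (proj₁ i′) c≤μ) (F₁-yes r c in-ν) (F₂-no r c λ i′ → <⇒≱ (proj₁ i′) c≤μ)
      (subst (λ C → termAt r c (cell r c) ≈T oneT ⊗ (termAt r c C ⊗ oneT)) (sym lower≡)
             (≈T-sym (≈T-trans (⊗-identityˡ _) (⊗-identityʳ _))))
      where
      0<c : 0 < c
      0<c = Inside-[]⁻ la r i
      in-ν : Inside ν [] r c
      in-ν = Inside-[] ν r 0<c (ν⇐ r c 0<c (proj₂ i) (AllLow⇒HasLow (nonempty r c 0<c (proj₂ i)) all))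
      c≤μ : c ≤ part μ r
      c≤μ = μ⇐ r c 0<c (proj₂ i) all
      lower≡ : lower (cell r c) ≡ cell r c
      lower≡ = trans (sym (List.++-identityʳ _)) (trans (cong (lower (cell r c) ++_) (sym (upper-empty _ all)))
                     (lower++upper (cell r c) (proj₁ (proj₂ (valid-cell cellwise r c i)))))

    high-cell : ∀ r c → Inside la [] r c → ¬ HasLow (cell r c) →
      termAt r c (cell r c) ≈T Fβ r c ⊗ (F₁ r c ⊗ F₂ r c)
    high-cell r c i ¬low = rewrite-factors r c
      (Fβ-no r c λ i′ → ¬low (proj₂ (ν⇒ r c 0<c (proj₂ i′))))
      (F₁-no r c λ i′ → ¬low (proj₂ (ν⇒ r c 0<c (proj₂ i′))))
      (F₂-yes r c in-λ/μ)
      (subst (λ C → termAt r c (cell r c) ≈T oneT ⊗ (oneT ⊗ termAt r c C)) (sym upper≡)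
             (≈T-sym (≈T-trans (⊗-identityˡ _) (⊗-identityˡ _))))
      where
      0<c : 0 < c
      0<c = Inside-[]⁻ la r i
      in-λ/μ : Inside la μ r c
      in-λ/μ = ≰⇒> (λ c≤μ → ¬low (AllLow⇒HasLow (nonempty r c 0<c (proj₂ i)) (proj₂ (μ⇒ r c 0<c c≤μ)))) , proj₂ i
      upper≡ : upper (cell r c) ≡ cell r c
      upper≡ = trans (cong (_++ upper (cell r c)) (sym (lower-empty _ ¬low)))
                     (lower++upper (cell r c) (proj₁ (proj₂ (valid-cell cellwise r c i))))

  cell-factorises : ∀ r c → F r c ≈T Fβ r c ⊗ (F₁ r c ⊗ F₂ r c)
  cell-factorises r c with Inside? la [] r c
  ... | no out = outside-cell r c out
  ... | yes i with HasLow? (cell r c) | AllLow? (cell r c)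
  ...   | yes low | no ¬all = mixed-cell r c i low ¬all
  ...   | yes _   | yes all = low-cell r c i all
  ...   | no ¬low | _       = high-cell r c i ¬low

  splitTab-term : LHSTerm T ≈T RHSTerm (splitTab la T)
  splitTab-term = begin
    tabTerm [] T                                        ≈⟨ T≈ ⟩
    ∏grid R K F                                         ≈⟨ ∏grid-cong R K _ _ cell-factorises ⟩
    ∏grid R K (λ r c → Fβ r c ⊗ (F₁ r c ⊗ F₂ r c))      ≈⟨ ∏grid-⊗ R K Fβ _ ⟩
    ∏grid R K Fβ ⊗ ∏grid R K (λ r c → F₁ r c ⊗ F₂ r c)  ≈⟨ ⊗-cong (≈T-refl {∏grid R K Fβ}) (∏grid-⊗ R K F₁ F₂) ⟩
    ∏grid R K Fβ ⊗ (∏grid R K F₁ ⊗ ∏grid R K F₂)        ≈⟨ ⊗-cong β^skew≈ (⊗-cong lowerTab≈ upperTab≈) ⟨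
    RHSTerm (splitTab la T)                             ∎
    where open ≈-Reasoning

Tab-≟ : DecidableEquality Tab
Tab-≟ = List.≡-dec (List.≡-dec (List.≡-dec (Productₚ.≡-dec ℤ._≟_ (Productₚ.≡-dec Bool._≟_ _≟_))))

-- every cell of λ/μ lies in the box [0, ℓ(λ)] × [0, |λ|]
allInside? : ∀ la mu (X : ℕ → ℕ → Set) → (∀ r c → Dec (X r c)) → Dec (∀ r c → Inside la mu r c → X r c)
allInside? la mu X X?
  with allUpTo? (λ r → allUpTo? (λ c → Inside? la mu r c →-dec X? r c) (suc (size la))) (suc (length la))
... | yes all = yes λ r c i → all (row-bound r c i) (s≤s (≤-trans (proj₂ i) (part≤size la r))) i
  where
  row-bound : ∀ r c → Inside la mu r c → r < suc (length la)
  row-bound r c i with 0<part⇒row la r (<-≤-trans (≤-<-trans z≤n (proj₁ i)) (proj₂ i))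
  ... | k , refl , k<ℓ = s≤s k<ℓ
... | no ¬all = no λ all → ¬all λ {r} _ {c} _ i → all r c i

NonEmpty? : (C : Cell) → Dec (NonEmpty C)
NonEmpty? []      = no λ ()
NonEmpty? (_ ∷ _) = yes tt

flag? : (phi : List ℤ) (r : ℕ) (C : Cell) → Dec ((f : ℤ) → at phi r ≡ just f → All (λ e → key e ℤ.≤ f) C)
flag? phi r C with at phi r
... | nothing = yes λ f ()
... | just f₀ with All.all? (λ e → key e ℤ.≤? f₀) C
...   | yes all = yes λ { f refl → all }
...   | no ¬all = no λ all → ¬all (all f₀ refl)

positive? : (pos : Bool) (C : Cell) → Dec (T pos → All IsHigh C)
positive? false C = yes λ ()
positive? true  C with All.all? high? C
... | yes all = yes λ _ → all
... | no ¬all = no λ all → ¬all (all tt)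

ValidCell? : ∀ phi pos r C → Dec (ValidCell phi pos r C)
ValidCell? phi pos r C =
  NonEmpty? C ×-dec AllPairs.allPairs? (λ e e′ → key e ℤ.<? key e′) C ×-dec flag? phi r C ×-dec positive? pos C

_≤ᶜ?_ : (C D : Cell) → Dec (C ≤ᶜ D)
C ≤ᶜ? D = All.all? (λ e → All.all? (λ e′ → key e ℤ.≤? key e′) D) C

_<ᶜ?_ : (C D : Cell) → Dec (C <ᶜ D)
C <ᶜ? D = All.all? (λ e → All.all? (λ e′ → key e ℤ.<? key e′) D) C

CellwiseSSVT? : ∀ la mu phi pos f → Dec (CellwiseSSVT la mu phi pos f)
CellwiseSSVT? la mu phi pos f
  with allInside? la mu (λ r c → ValidCell phi pos r (f r c)) (λ r c → ValidCell? phi pos r (f r c))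
     | allInside? la mu (λ r c → Inside la mu r (suc c) → f r c ≤ᶜ f r (suc c))
                        (λ r c → Inside? la mu r (suc c) →-dec _ ≤ᶜ? _)
     | allInside? la mu (λ r c → Inside la mu (suc r) c → f r c <ᶜ f (suc r) c)
                        (λ r c → Inside? la mu (suc r) c →-dec _ <ᶜ? _)
... | yes cells | yes rows | yes columns = yes record { valid-cell = cells ; row-weak = rows ; column-strict = columns }
... | no ¬cells | _        | _           = no (¬cells ∘ valid-cell)
... | _         | no ¬rows | _           = no (¬rows ∘ row-weak)
... | _         | _        | no ¬columns = no (¬columns ∘ column-strict)

allRows? : (P : ℕ → List Cell → Set) → (∀ r row → Dec (P r row)) →
  (Tb : Tab) → Dec (∀ r row → at Tb r ≡ just row → P r row)
allRows? P P? []         = yes λ { zero _ () ; (suc r) _ () }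
allRows? P P? (row ∷ Tb) with P? 1 row | allRows? (P ∘ suc) (P? ∘ suc) Tb
... | no ¬p | _       = no λ all → ¬p (all 1 row refl)
... | yes _ | no ¬all = no λ all → ¬all λ { zero _ () ; (suc r) row′ e → all (suc (suc r)) row′ e }
... | yes p | yes all = yes λ { zero _ () ; (suc zero) _ refl → p ; (suc (suc r)) row′ e → all (suc r) row′ e }

SSVT? : ∀ la mu phi pos Tb → Dec (SSVT la mu phi pos Tb)
SSVT? la mu phi pos Tb
  with length Tb ≟ length la
     | allRows? (λ r row → length row ≡ part la r ∸ part mu r) (λ r row → length row ≟ part la r ∸ part mu r) Tb
... | no ¬ℓ≡ | _        = no (¬ℓ≡ ∘ proj₁)
... | yes _  | no ¬rowℓ = no (¬rowℓ ∘ proj₁ ∘ proj₂)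
... | yes ℓ≡ | yes rowℓ with CellwiseSSVT? la mu phi pos (cellOf Tb mu)
...   | yes cw  = yes (subst (SSVT la mu phi pos) (sym (≡-tabulateTab Tb la mu ℓ≡ rowℓ))
                             (CellwiseSSVT⇒SSVT la mu phi pos _ cw))
...   | no ¬cw  = no (¬cw ∘ SSVT⇒CellwiseSSVT la mu phi pos Tb)

-- Finitely many tableaux per monomial

∈-concatMap : {A B : Set} (f : A → List B) {x : A} {xs : List A} {y : B} →
  x ∈ xs → y ∈ f x → y ∈ concatMap f xs
∈-concatMap f x∈xs y∈fx = ∈.∈-concatMap⁺ f (Any.map (λ { refl → y∈fx }) x∈xs)

∈-range : ∀ s n j → j < n → s + j ∈ range s n
∈-range s (suc n) zero    _         = here (+-identityʳ s)
∈-range s (suc n) (suc j) (s≤s j<n) = there (subst (_∈ range (suc s) n) (sym (+-suc s j)) (∈-range (suc s) n j j<n))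

∈⇒nth : {A : Set} {x : A} (p : List A) → x ∈ p → Σ ℕ λ j → nth p j ≡ just x
∈⇒nth (y ∷ p) (here refl) = 0 , refl
∈⇒nth (y ∷ p) (there x∈p) = Product.map suc (λ e → e) (∈⇒nth p x∈p)

listsOfLength : {A : Set} → ℕ → List A → List (List A)
listsOfLength zero    X = [] ∷ []
listsOfLength (suc n) X = concatMap (λ x → map (x ∷_) (listsOfLength n X)) X

listsUpTo : {A : Set} → ℕ → List A → List (List A)
listsUpTo zero    X = [] ∷ []
listsUpTo (suc n) X = [] ∷ concatMap (λ x → map (x ∷_) (listsUpTo n X)) X

tabsOfShape : List ℕ → List Cell → List Tab
tabsOfShape []        X = [] ∷ []
tabsOfShape (l ∷ la) X = concatMap (λ row → map (row ∷_) (tabsOfShape la X)) (listsOfLength l X)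

∈-listsOfLength : {A : Set} (X : List A) (n : ℕ) (p : List A) → length p ≡ n → All (_∈ X) p → p ∈ listsOfLength n X
∈-listsOfLength X zero    []      _    _          = here refl
∈-listsOfLength X (suc n) (x ∷ p) refl (x∈ ∷ p⊆) =
  ∈-concatMap _ x∈ (∈.∈-map⁺ (x ∷_) (∈-listsOfLength X n p refl p⊆))

∈-listsUpTo : {A : Set} (X : List A) (n : ℕ) (p : List A) → length p ≤ n → All (_∈ X) p → p ∈ listsUpTo n X
∈-listsUpTo X zero    []      _         _          = here refl
∈-listsUpTo X (suc n) []      _         _          = here refl
∈-listsUpTo X (suc n) (x ∷ p) (s≤s ℓ≤n) (x∈ ∷ p⊆) =
  there (∈-concatMap _ x∈ (∈.∈-map⁺ (x ∷_) (∈-listsUpTo X n p ℓ≤n p⊆)))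

∈-tabsOfShape : (X : List Cell) (la : List ℕ) (T : Tab) → length T ≡ length la →
  (∀ k row → nth T k ≡ just row → length row ≡ part la (suc k) × All (_∈ X) row) → T ∈ tabsOfShape la X
∈-tabsOfShape X []       []        _  _    = here refl
∈-tabsOfShape X (l ∷ la) (row ∷ T) ℓ≡ rows = ∈-concatMap _
  (∈-listsOfLength X l row (proj₁ (rows 0 row refl)) (proj₂ (rows 0 row refl)))
  (∈.∈-map⁺ (row ∷_) (∈-tabsOfShape X la T (suc-injective ℓ≡) (rows ∘ suc)))

∏range-factor : ∀ F s n j → j < n → Σ STerm λ rest → ∏range F s n ≈T F (s + j) ⊗ rest
∏range-factor F s (suc n) zero    _         =
  ∏range F (suc s) n , subst (λ k → ∏range F s (suc n) ≈T F k ⊗ ∏range F (suc s) n) (sym (+-identityʳ s)) ≈T-refl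
∏range-factor F s (suc n) (suc j) (s≤s j<n) with ∏range-factor F (suc s) n j j<n
... | rest , e = F s ⊗ rest , subst (λ k → ∏range F s (suc n) ≈T F k ⊗ (F s ⊗ rest)) (sym (+-suc s j))
                               (≈T-trans (⊗-cong (≈T-refl {F s}) e) (x∙yz≈y∙xz (F s) (F (suc s + j)) rest))

∏grid-factor : ∀ R K F r c → 0 < r → r ≤ R → 0 < c → c ≤ K → Σ STerm λ rest → ∏grid R K F ≈T F r c ⊗ rest
∏grid-factor R K F (suc i) (suc j) _ i<R _ j<K
  with ∏range-factor (λ r → ∏range (F r) 1 K) 1 R i i<R | ∏range-factor (F (suc i)) 1 K j j<K
... | rest₁ , e₁ | rest₂ , e₂ =
  rest₂ ⊗ rest₁ , ≈T-trans e₁ (≈T-trans (⊗-cong e₂ (≈T-refl {rest₁})) (⊗-assoc (F (suc i) (suc j)) rest₂ rest₁))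

∈-cellTerm-xs : ∀ d C {e x} → e ∈ C → x ∈ xs (proj₁ (entryTerm d e)) → x ∈ xs (proj₁ (cellTerm d C))
∈-cellTerm-xs d (e ∷ C)  (here refl) x∈ = ∈.∈-++⁺ˡ x∈
∈-cellTerm-xs d (e′ ∷ C) (there e∈) x∈ = ∈.∈-++⁺ʳ (xs (proj₁ (entryTerm d e′))) (∈-cellTerm-xs d C e∈ x∈)

∈-cellTerm-ys : ∀ d C {e y} → e ∈ C → y ∈ ys (proj₁ (entryTerm d e)) → y ∈ ys (proj₁ (cellTerm d C))
∈-cellTerm-ys d (e ∷ C)  (here refl) y∈ = ∈.∈-++⁺ˡ y∈
∈-cellTerm-ys d (e′ ∷ C) (there e∈) y∈ = ∈.∈-++⁺ʳ (ys (proj₁ (entryTerm d e′))) (∈-cellTerm-ys d C e∈ y∈)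

length-ys-entry≤cell : ∀ d C {e} → e ∈ C → length (ys (proj₁ (entryTerm d e))) ≤ length (ys (proj₁ (cellTerm d C)))
length-ys-entry≤cell d (e ∷ C) (here refl) =
  subst (_ ≤_) (sym (List.length-++ (ys (proj₁ (entryTerm d e))))) (m≤m+n _ _)
length-ys-entry≤cell d (e′ ∷ C) (there e∈) =
  subst (_ ≤_) (sym (List.length-++ (ys (proj₁ (entryTerm d e′))))) (≤-trans (length-ys-entry≤cell d C e∈) (m≤n+m _ _))

degree : STerm → ℕ
degree t = length (xs (proj₁ t)) + length (ys (proj₁ t))

-- every entry contributes at least one variable x or y
length≤degree-cellTerm : ∀ d C → length C ≤ degree (cellTerm d C)
length≤degree-cellTerm d []      = z≤n
length≤degree-cellTerm d (e ∷ C) = subst (suc (length C) ≤_) (sym degree-∷)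
  (+-mono-≤ (entry-degree e) (length≤degree-cellTerm d C))
  where
  entry-degree : ∀ e → 1 ≤ degree (entryTerm d e)
  entry-degree (i , true  , n) = s≤s z≤n
  entry-degree (i , false , n) = subst (1 ≤_) (sym (List.length-replicate (suc n))) (s≤s z≤n)
  degree-∷ : degree (cellTerm d (e ∷ C)) ≡ degree (entryTerm d e) + degree (cellTerm d C)
  degree-∷ = trans (cong₂ _+_ (List.length-++ (xs (proj₁ (entryTerm d e)))) (List.length-++ (ys (proj₁ (entryTerm d e)))))
                   (+-interchange (length (xs (proj₁ (entryTerm d e)))) (length (xs (proj₁ (cellTerm d C))))
                                  (length (ys (proj₁ (entryTerm d e)))) (length (ys (proj₁ (cellTerm d C)))))

length≤-↭-++ : {A : Set} {p : List A} (q : List A) {r : List A} → p ↭ q ++ r → length q ≤ length p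
length≤-↭-++ q {r} p↭ = subst (length q ≤_) (sym (trans (↭.↭-length p↭) (List.length-++ q))) (m≤m+n _ _)

-- an entry i of a cell with content d contributes x_i or y_{i+d}, and at most |ys m| further y's
module Candidates (la : List ℕ) (m : Mono) where

  contents : List ℤ
  contents = concatMap (λ r → map (λ c → ℤ.+ c ℤ.- ℤ.+ r) (range 1 (size la))) (range 1 (length la))

  keys : List ℤ
  keys = xs m ++ concatMap (λ y → map (λ d → y ℤ.- d) contents) (ys m)

  withFlag : ℤ → Bool → List Entry
  withFlag i b = map (λ n → i , b , n) (range 0 (suc (length (ys m))))

  entriesWithKey : ℤ → List Entry
  entriesWithKey i = concatMap (withFlag i) (true ∷ false ∷ [])

  candidates : List Tab
  candidates = tabsOfShape la (listsUpTo (length (xs m) + length (ys m)) (concatMap entriesWithKey keys))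

  ∈-entries : ∀ d i b n → d ∈ contents →
    (∀ {x} → x ∈ xs (proj₁ (entryTerm d (i , b , n))) → x ∈ xs m) →
    (∀ {y} → y ∈ ys (proj₁ (entryTerm d (i , b , n))) → y ∈ ys m) →
    length (ys (proj₁ (entryTerm d (i , b , n)))) ≤ length (ys m) →
    (i , b , n) ∈ concatMap entriesWithKey keys
  ∈-entries d i true n d∈ x⊆ y⊆ ℓ≤ = ∈-concatMap entriesWithKey (∈.∈-++⁺ˡ (x⊆ (here refl)))
    (∈-concatMap (withFlag i) {xs = true ∷ false ∷ []} (here refl)
                 (∈.∈-map⁺ (λ n → i , true , n) (∈-range 0 _ n (s≤s n≤))))
    where
    n≤ : n ≤ length (ys m)
    n≤ = subst (_≤ length (ys m)) (List.length-replicate n) ℓ≤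
  ∈-entries d i false n d∈ x⊆ y⊆ ℓ≤ = ∈-concatMap entriesWithKey i∈keys
    (∈-concatMap (withFlag i) {xs = true ∷ false ∷ []} (there (here refl))
                 (∈.∈-map⁺ (λ n → i , false , n) (∈-range 0 _ n (s≤s n≤))))
    where
    n≤ : n ≤ length (ys m)
    n≤ = ≤-trans (n≤1+n n) (subst (_≤ length (ys m)) (List.length-replicate (suc n)) ℓ≤)
    [i+d]-d≡i : (i ℤ.+ d) ℤ.- d ≡ i
    [i+d]-d≡i = trans (ℤₚ.+-assoc i d (ℤ.- d)) (trans (cong (λ z → i ℤ.+ z) (ℤₚ.+-inverseʳ d)) (ℤₚ.+-identityʳ i))
    i∈keys : i ∈ keys
    i∈keys = ∈.∈-++⁺ʳ (xs m) (∈-concatMap _ (y⊆ (here refl))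
      (subst (_∈ map (λ d′ → (i ℤ.+ d) ℤ.- d′) contents) [i+d]-d≡i (∈.∈-map⁺ (λ d′ → (i ℤ.+ d) ℤ.- d′) d∈)))

  module _ (phi : List ℤ) (la-partition : IsPartition la) (T : Tab) (v : LHSValid la phi T)
    (T≈m : proj₁ (LHSTerm T) ≈M m) where
    open SplitTerm la phi la-partition T v using (T≈; F; R; K)

    cell∈candidates : ∀ k j row C → nth T k ≡ just row → nth row j ≡ just C →
      C ∈ listsUpTo (length (xs m) + length (ys m)) (concatMap entriesWithKey keys)
    cell∈candidates k j row C row-k C-j = ∈-listsUpTo _ _ C C≤ (All.tabulate e∈)
      where
      d : ℤ
      d = ℤ.+ (suc j) ℤ.- ℤ.+ (suc k)
      row-length : length row ≡ part la (suc k)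
      row-length = proj₁ (proj₂ v) (suc k) row row-k
      k<R : k < R
      k<R = subst (k <_) (proj₁ v) (nth-length T k row-k)
      inside : Inside la [] (suc k) (suc j)
      inside = s≤s z≤n , subst (suc j ≤_) row-length (nth-length row j C-j)
      j<K : suc j ≤ K
      j<K = ≤-trans (proj₂ inside) (part≤size la (suc k))
      factor : Σ STerm λ rest → ∏grid R K F ≈T F (suc k) (suc j) ⊗ rest
      factor = ∏grid-factor R K F (suc k) (suc j) z<s k<R z<s j<K
      rest : STerm
      rest = proj₁ factor
      F≡ : F (suc k) (suc j) ≡ cellTerm d C
      F≡ = trans (select-yes (Inside? la [] (suc k) (suc j)) _ inside)
                 (cong (cellTerm d ∘ fromMaybe []) (trans (cellAt-just T [] (suc k) (suc j) row-k) C-j))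
      T≈C⊗rest : tabTerm [] T ≈T cellTerm d C ⊗ rest
      T≈C⊗rest = ≈T-trans T≈ (≈T-trans (proj₂ factor) (⊗-cong (≡⇒≈T F≡) (≈T-refl {rest})))
      xs≈ : xs m ↭ xs (proj₁ (cellTerm d C)) ++ xs (proj₁ rest)
      xs≈ = ↭-trans (↭-sym (proj₁ (proj₂ T≈m))) (proj₁ (proj₂ (proj₁ T≈C⊗rest)))
      ys≈ : ys m ↭ ys (proj₁ (cellTerm d C)) ++ ys (proj₁ rest)
      ys≈ = ↭-trans (↭-sym (proj₂ (proj₂ T≈m))) (proj₂ (proj₂ (proj₁ T≈C⊗rest)))
      C≤ : length C ≤ length (xs m) + length (ys m)
      C≤ = ≤-trans (length≤degree-cellTerm d C)
                   (+-mono-≤ (length≤-↭-++ (xs (proj₁ (cellTerm d C))) xs≈) (length≤-↭-++ (ys (proj₁ (cellTerm d C))) ys≈))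
      d∈ : d ∈ contents
      d∈ = ∈-concatMap _ (∈-range 1 R k k<R) (∈.∈-map⁺ (λ c → ℤ.+ c ℤ.- ℤ.+ (suc k)) (∈-range 1 K j j<K))
      e∈ : ∀ {e} → e ∈ C → e ∈ concatMap entriesWithKey keys
      e∈ {i , b , n} e∈C = ∈-entries d i b n d∈
        (λ x∈ → ↭.∈-resp-↭ (↭-sym xs≈) (∈.∈-++⁺ˡ (∈-cellTerm-xs d C e∈C x∈)))
        (λ y∈ → ↭.∈-resp-↭ (↭-sym ys≈) (∈.∈-++⁺ˡ (∈-cellTerm-ys d C e∈C y∈)))
        (≤-trans (length-ys-entry≤cell d C e∈C) (length≤-↭-++ (ys (proj₁ (cellTerm d C))) ys≈))

    ∈-candidates : T ∈ candidates
    ∈-candidates = ∈-tabsOfShape _ la T (proj₁ v) λ k row row-k →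
      proj₁ (proj₂ v) (suc k) row row-k , All.tabulate λ C∈ →
        let j , C-j = ∈⇒nth row C∈ in cell∈candidates k j row _ row-k C-j

corollary3p3 : (la : List ℕ) (phi : List ℤ) → IsPartition la → IsFlag la phi →
    Compatible la phi → (m : Mono) →
    Σ ℤ (λ c → HasCoeff (LHSValid la phi) LHSTerm m c
             × HasCoeff (RHSValid la phi) RHSTerm m c)
corollary3p3 la phi la-partition (phi-length , _) _ m with lhs-coefficient
  where
  open Candidates la m using (candidates; ∈-candidates)
  lhs-coefficient : Σ ℤ (HasCoeff (LHSValid la phi) LHSTerm m)
  lhs-coefficient = coefficient-from-candidates Tab-≟ (LHSValid la phi) (SSVT? la [] phi false) LHSTerm m
    candidates (∈-candidates phi la-partition)
... | c , lhs = c , lhs , HasCoeff-bijection (splitTab la) (mergeTab la)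
  (λ {T} → SplitTableau.splitTab-valid la phi la-partition T)
  (λ {j} → MergeTableaux.mergeTab-valid la phi phi-length j)
  (λ {T} → mergeTab-splitTab la phi la-partition T)
  (λ {j} → splitTab-mergeTab la phi la-partition phi-length j)
  (λ {T} → SplitTerm.splitTab-term la phi la-partition T)
  lhs
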